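{- Let $K$ be a field, let $H$ be a subgroup of $K^\times$, and let $\varphi:K\to F$ be the canonical quotient map to the quotient hyperfield $F=K/H$. For an $n\times n$ matrix $A$ over $F$, the following are equivalent: (1) every matrix $A'$ over $K$ with $\varphi(A')=A$ is nonsingular; (2) the columns of $A$ are $F$-linearly independent; (3) $r_{\mathrm{mat}}(A)=n$; (4) $r_{\mathrm{mat}}(A^T)=n$.
   Context: A tract is a multiplicatively written commutative monoid $F$ with an absorbing element $0$ such that $F^\times=F\setminus\{0\}$ is a group, together with a null set $N_F\subseteq\mathbb{N}[F^\times]$ containing the empty sum, containing $1+\epsilon$ for a unique $\epsilon\in F^\times$, and closed under $F^\times$-scaling (formal sums are read with zero terms discarded). The quotient hyperfield $F=K/H$ is the monoid $(K^\times/H)\cup\{0\}$ with null set consisting of the formal sums $\sum_{i=1}^k x_i$ of cosets for which there exist representatives $\tilde x_i\in x_i$ with $\sum_i\tilde x_i=0$ in $K$; $\varphi:K\to F$ is the quotient map, applied entrywise. $X,Y\in F^n$ are orthogonal if $\sum_iX_iY_i\in N_F$. Vectors $X_1,\dots,X_k\in F^n$ are $F$-linearly dependent if there are $c_i\in F$, not all zero, with $\sum_ic_iX_i\in(N_F)^n$ coordinatewise, and linearly independent otherwise. An $F$-matroid $M$ of rank $r$ on $[n]$ is a rank-$r$ matroid $\underline{M}$ on $[n]$ with subsets $\mathcal{C}(M),\mathcal{C}^*(M)\subseteq F^n$ ($F$-circuits, $F$-cocircuits), closed under $F^\times$-scaling, whose supports are circuits (resp. cocircuits) of $\underline{M}$,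 each circuit (resp. cocircuit) being the support of an $F$-circuit (resp. $F$-cocircuit) unique up to scaling, and every $F$-circuit orthogonal to every $F$-cocircuit. Covectors of $M$: elements of $F^n$ orthogonal to all $F$-circuits. The matroidal rank $r_{\mathrm{mat}}(B)$ of a matrix $B$ over $F$ with $n$ columns is the minimal rank of an $F$-matroid on $[n]$ having every row of $B$ as a covector. -}

module Defs where

open import Level using (Level; _⊔_) renaming (suc to lsuc)
open import Algebra.Bundles using (CommutativeRing)
open import Data.Nat as ℕ using (ℕ; zero; suc; _≤_)
open import Data.Fin using (Fin; zero; suc; punchIn; toℕ)
open import Data.Fin.Subset using (Subset; _∈_; _∉_; _⊆_; _-_; _∪_; ⁅_⁆; ∣_∣)
open import Data.Product using (Σ; ∃; ∃-syntax; _×_; _,_)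
open import Relation.Nullary using (¬_)
open import Relation.Unary using (Pred)
open import Relation.Binary.PropositionalEquality using (_≡_)

IsField : ∀ {c ℓ} → CommutativeRing c ℓ → Set (c ⊔ ℓ)
IsField K = (¬ (0# ≈ 1#)) × (∀ x → ¬ (x ≈ 0#) → ∃[ y ] (x * y ≈ 1#))
  where open CommutativeRing K

record IsUnitSubgroup {c ℓ h} (K : CommutativeRing c ℓ) (H : Pred (CommutativeRing.Carrier K) h)
       : Set (c ⊔ ℓ ⊔ h) where
  open CommutativeRing K using (Carrier; _≈_; _+_; _*_; -_; 0#; 1#)
  field
    resp    : ∀ {x y} → x ≈ y → H x → H y
    nonzero : ∀ {x} → H x → ¬ (x ≈ 0#)
    one     : H 1#
    mul     : ∀ {x y} → H x → H y → H (x * y)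
    inv     : ∀ {x} → H x → ∃[ y ] (H y × (x * y ≈ 1#))

record Matroid {L : Level} (n r : ℕ) : Set (lsuc L) where
  field
    IsBasis  : Pred (Subset n) L
    nonempty : ∃[ B ] IsBasis B
    exchange : ∀ B₁ B₂ → IsBasis B₁ → IsBasis B₂ → ∀ x → x ∈ B₁ → x ∉ B₂ →
               ∃[ y ] (y ∈ B₂ × y ∉ B₁ × IsBasis ((B₁ - x) ∪ ⁅ y ⁆))
    rank     : ∀ B → IsBasis B → ∣ B ∣ ≡ r

  Independent : Subset n → Set L
  Independent I = ∃[ B ] (IsBasis B × I ⊆ B)

  IsCircuit : Subset n → Set L
  IsCircuit C = (¬ Independent C) × (∀ e → e ∈ C → Independent (C - e))

  -- minimal sets meeting every basis
  IsCocircuit : Subset n → Set L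
  IsCocircuit C = (∀ B → IsBasis B → ∃[ e ] (e ∈ C × e ∈ B))
                × (∀ e → e ∈ C → ∃[ B ] (IsBasis B × (∀ x → x ∈ (C - e) → x ∉ B)))

-- The quotient hyperfield F = K/H, with elements represented by elements
-- of K (x represents the coset xH, 0 represents 0).

module QuotientHyperfield {c ℓ h} (K : CommutativeRing c ℓ)
                          (H : Pred (CommutativeRing.Carrier K) h) where
  open CommutativeRing K using (Carrier; _≈_; _+_; _*_; -_; 0#; 1#)

  L : Level
  L = c ⊔ ℓ ⊔ h

  sum : ∀ n → (Fin n → Carrier) → Carrier
  sum zero    f = 0#
  sum (suc n) f = f zero + sum n (λ i → f (suc i))

  sgn : ℕ → Carrier
  sgn zero    = 1#
  sgn (suc k) = - sgn k

  det : ∀ n → (Fin n → Fin n → Carrier) → Carrier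
  det zero    A = 1#
  det (suc n) A = sum (suc n) (λ j → sgn (toℕ j) * A zero j * det n (λ r s → A (suc r) (punchIn j s)))

  Nonsingular : ∀ {n} → (Fin n → Fin n → Carrier) → Set ℓ
  Nonsingular {n} A = ¬ (det n A ≈ 0#)

  -- x and y represent the same element of F = K/H  (φ(x) = φ(y))
  _∼_ : Carrier → Carrier → Set (c ⊔ ℓ ⊔ h)
  x ∼ y = Σ Carrier λ g → (H g × (x ≈ g * y))

  FVec : ℕ → Set c
  FVec n = Fin n → Carrier

  _≋_ : ∀ {n} → FVec n → FVec n → Set L
  X ≋ Y = ∀ i → X i ∼ Y i

  -- the formal sum Σ φ(x i) lies in the null set N_F
  Null : ∀ n → (Fin n → Carrier) → Set L
  Null n x = Σ (Fin n → Carrier) λ g → ((∀ i → H (g i)) × (sum n (λ i → g i * x i) ≈ 0#))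

  Orthogonal : ∀ {n} → FVec n → FVec n → Set L
  Orthogonal {n} X Y = Null n (λ i → X i * Y i)

  ColumnsDependent : ∀ {m k} → (Fin m → Fin k → Carrier) → Set L
  ColumnsDependent {m} {k} B =
    Σ (Fin k → Carrier) λ a → ((∃[ j ] (¬ (a j ≈ 0#))) × (∀ i → Null k (λ j → a j * B i j)))

  ColumnsIndependent : ∀ {m k} → (Fin m → Fin k → Carrier) → Set L
  ColumnsIndependent B = ¬ ColumnsDependent B

  Support : ∀ {n} → FVec n → Subset n → Set ℓ
  Support X S = ∀ i → (i ∈ S → ¬ (X i ≈ 0#)) × (i ∉ S → X i ≈ 0#)

  record FMatroid (n r : ℕ) : Set (lsuc L) where
    field
      underlying : Matroid {L} n r
    open Matroid underlying public
    field
      Circ   : Pred (FVec n) L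
      Cocirc : Pred (FVec n) L
      -- they are subsets of F^n (well defined on representatives)
      Circ-resp   : ∀ {X Y} → Circ X → X ≋ Y → Circ Y
      Cocirc-resp : ∀ {X Y} → Cocirc X → X ≋ Y → Cocirc Y
      Circ-scale   : ∀ {X} a → ¬ (a ≈ 0#) → Circ X → Circ (λ i → a * X i)
      Cocirc-scale : ∀ {X} a → ¬ (a ≈ 0#) → Cocirc X → Cocirc (λ i → a * X i)
      Circ-supp   : ∀ {X S} → Circ X → Support X S → IsCircuit S
      Cocirc-supp : ∀ {X S} → Cocirc X → Support X S → IsCocircuit S
      Circ-exists   : ∀ S → IsCircuit S → ∃[ X ] (Circ X × Support X S)
      Cocirc-exists : ∀ S → IsCocircuit S → ∃[ X ] (Cocirc X × Support X S)
      Circ-unique   : ∀ {X Y S} → Circ X → Circ Y → Support X S → Support Y S →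
                      ∃[ a ] ((¬ (a ≈ 0#)) × (Y ≋ (λ i → a * X i)))
      Cocirc-unique : ∀ {X Y S} → Cocirc X → Cocirc Y → Support X S → Support Y S →
                      ∃[ a ] ((¬ (a ≈ 0#)) × (Y ≋ (λ i → a * X i)))
      orth : ∀ {X Y} → Circ X → Cocirc Y → Orthogonal X Y

    Covector : FVec n → Set L
    Covector Y = ∀ X → Circ X → Orthogonal X Y

  RowsCovectors : ∀ {m n r} → FMatroid n r → (Fin m → Fin n → Carrier) → Set L
  RowsCovectors M B = ∀ i → FMatroid.Covector M (B i)

  MatroidalRank : ∀ {m n} → (Fin m → Fin n → Carrier) → ℕ → Set (lsuc L)
  MatroidalRank {m} {n} B k =
    (∃[ M ] RowsCovectors {m} {n} {k} M B) ×
    (∀ r (M : FMatroid n r) → RowsCovectors M B → k ≤ r)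

  transpose : ∀ {m n} → (Fin m → Fin n → Carrier) → Fin n → Fin m → Carrier
  transpose B i j = B j i

  AllLiftsNonsingular : ∀ {n} → (Fin n → Fin n → Carrier) → Set (c ⊔ ℓ ⊔ h)
  AllLiftsNonsingular {n} A = ∀ A' → (∀ i j → A' i j ∼ A i j) → Nonsingular A'

module Submission where

-- Over K, Gaussian elimination on the first row (column operations, then Laplace expansion)
-- shows that a square matrix is either nonsingular with trivial kernel and spanning columns,
-- or singular with a nonzero kernel and cokernel.  A lift A′ of A with a kernel vector v is
-- the same as an F-linear dependency φ(v) of the columns of A, so (1) ⇔ (2); lifts of Aᵀ are
-- transposes of lifts of A, so (1) ⇔ (2) for Aᵀ.  For (2) ⇔ (3): the free F-matroid of rank n
-- has no circuits, so the rows are its covectors, and in an F-matroid of rank r < n an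
-- F-circuit X orthogonal to all rows is an F-dependency of the columns.  Conversely a
-- dependency a gives the F-matroid of rank n − 1 whose F-circuits are the multiples of a,
-- and the rows are its covectors.  Then (4) is (3) for Aᵀ.

open import Level using (_⊔_; Lift; lift; lower)
open import Algebra.Bundles using (CommutativeRing)
import Algebra.Properties.CommutativeSemigroup as CommutativeSemigroupProperties
import Algebra.Properties.Ring as RingProperties
import Algebra.Properties.Semiring.Sum as SemiringSum
open import Data.Empty using (⊥; ⊥-elim)
open import Data.Fin using (Fin; zero; suc; punchIn; punchOut; toℕ; inject₁)
open import Data.Fin.Properties
  using (_≟_; all?; ¬∀⟶∃¬; toℕ-injective; toℕ-inject₁; punchInᵢ≢i; punchIn-punchOut; punchIn-injective)
  renaming (<-cmp to <-cmpᶠ)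
open import Data.Fin.Subset using (Subset; _∈_; _∉_; _⊆_; _-_; _∪_; ⁅_⁆; ∣_∣; ⊤; ∁; Nonempty)
open import Data.Fin.Subset.Properties
  using (_∈?_; nonempty?; ∈⊤; ∣⊤∣≡n; ⊆-antisym; p⊆q⇒∣p∣≤∣q∣; x∈p⇒∣p-x∣<∣p∣; p─q⊆p; x∈p∧x≢y⇒x∈p-y;
         x∈∁p⇒x∉p; x∉p⇒x∈∁p; x∉∁p⇒x∈p; x∈⁅x⁆; x∈⁅y⁆⇒x≡y; x≢y⇒x∉⁅y⁆; x∈p∪q⁻; x∈p∪q⁺;
         ∣∁p∣≡n∸∣p∣; ∣⁅x⁆∣≡1)
import Data.Vec.Base as Vec
open import Data.List using ([]; _∷_; allFin)
open import Data.List.Membership.Propositional using () renaming (_∉_ to _∉ᴸ_)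
open import Data.List.Membership.Propositional.Properties using (∈-allFin)
open import Data.List.Relation.Unary.Any using (here; there)
open import Data.Nat as ℕ using (ℕ; zero; suc)
import Data.Nat.Properties as ℕₚ
open import Data.Product using (Σ; ∃; ∃-syntax; _×_; _,_; proj₁; proj₂)
open import Data.Sum using (_⊎_; inj₁; inj₂)
open import Data.Vec.Functional using (updateAt; insertAt)
open import Data.Vec.Functional.Properties
  using (updateAt-updates; updateAt-minimal; updateAt-commutes; updateAt-id-local;
         insertAt-lookup; insertAt-punchIn)
open import Function using (_∘_)
open import Function.Bundles using (_⇔_; mk⇔)
open import Function.Construct.Composition using (_⇔-∘_)
open import Relation.Binary using (tri<; tri≈; tri>)
import Relation.Binary.PropositionalEquality as ≡
open ≡ using (_≡_; _≢_; refl)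
open import Relation.Nullary using (¬_; Dec; yes; no; ¬¬-excluded-middle)
open import Relation.Nullary.Negation using (¬¬-map)
open import Relation.Nullary.Decidable using (decidable-stable)
open import Relation.Unary using (Pred)

open import Defs

punchIn-suc≡punchIn-inject₁ : ∀ {n} (i s : Fin n) → s ≢ i →
                              punchIn (suc i) s ≡ punchIn (inject₁ i) s
punchIn-suc≡punchIn-inject₁ zero    zero    s≢i = ⊥-elim (s≢i refl)
punchIn-suc≡punchIn-inject₁ zero    (suc s) s≢i = refl
punchIn-suc≡punchIn-inject₁ (suc i) zero    s≢i = refl
punchIn-suc≡punchIn-inject₁ (suc i) (suc s) s≢i =
  ≡.cong suc (punchIn-suc≡punchIn-inject₁ i s (s≢i ∘ ≡.cong suc))

punchIn-suc-self : ∀ {n} (i : Fin n) → punchIn (suc i) i ≡ inject₁ i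
punchIn-suc-self zero    = refl
punchIn-suc-self (suc i) = ≡.cong suc (punchIn-suc-self i)

punchIn-inject₁-self : ∀ {n} (i : Fin n) → punchIn (inject₁ i) i ≡ suc i
punchIn-inject₁-self zero    = refl
punchIn-inject₁-self (suc i) = ≡.cong suc (punchIn-inject₁-self i)

punchIn-cases : ∀ {n p} {P : Fin (suc n) → Set p} c → P c → (∀ k → P (punchIn c k)) → ∀ s → P s
punchIn-cases {P = P} c Pc Pk s with c ≟ s
... | yes refl = Pc
... | no c≢s   = ≡.subst P (punchIn-punchOut c≢s) (Pk (punchOut c≢s))

inject₁≢suc : ∀ {n} (i : Fin n) → inject₁ i ≢ suc i
inject₁≢suc i eq = ℕₚ.1+n≢n (≡.sym (≡.trans (≡.sym (toℕ-inject₁ i)) (≡.cong toℕ eq)))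

punchIn-adjacent : ∀ {m} (j : Fin (suc (suc m))) (i : Fin (suc m)) →
                   j ≢ inject₁ i → j ≢ suc i →
                   ∃[ i′ ] (punchIn j (inject₁ i′) ≡ inject₁ i × punchIn j (suc i′) ≡ suc i)
punchIn-adjacent zero zero j≢i _ = ⊥-elim (j≢i refl)
punchIn-adjacent zero (suc i) _ _ = i , refl , refl
punchIn-adjacent (suc zero) zero _ j≢1+i = ⊥-elim (j≢1+i refl)
punchIn-adjacent {zero} (suc (suc ())) zero _ _
punchIn-adjacent {suc m} (suc (suc j)) zero _ _ = zero , refl , refl
punchIn-adjacent {suc m} (suc j) (suc i) j≢i j≢1+i
  with punchIn-adjacent j i (j≢i ∘ ≡.cong suc) (j≢1+i ∘ ≡.cong suc)
... | i′ , p , q = suc i′ , ≡.cong suc p , ≡.cong suc q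

x∈p-y⇒x≢y : ∀ {n} {p : Subset n} {x y} → x ∈ p - y → x ≢ y
x∈p-y⇒x≢y {p = p} {x} x∈p-x refl = x∉p-x p x x∈p-x
  where
  x∉p-x : ∀ {n} (p : Subset n) x → x ∉ p - x
  x∉p-x (_ Vec.∷ p) zero    ()
  x∉p-x (_ Vec.∷ p) (suc x) (Vec.there x∈p-x) = x∉p-x p x x∈p-x

x∈∁⁅y⁆⇒x≢y : ∀ {n} {x y : Fin n} → x ∈ ∁ ⁅ y ⁆ → x ≢ y
x∈∁⁅y⁆⇒x≢y {y = y} x∈∁⁅y⁆ refl = x∈∁p⇒x∉p x∈∁⁅y⁆ (x∈⁅x⁆ y)

x∉∁⁅x⁆ : ∀ {n} (x : Fin n) → x ∉ ∁ ⁅ x ⁆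
x∉∁⁅x⁆ x x∈∁⁅x⁆ = x∈∁⁅y⁆⇒x≢y x∈∁⁅x⁆ refl

x≢y⇒x∈∁⁅y⁆ : ∀ {n} {x y : Fin n} → x ≢ y → x ∈ ∁ ⁅ y ⁆
x≢y⇒x∈∁⁅y⁆ = x∉p⇒x∈∁p ∘ x≢y⇒x∉⁅y⁆

x∉∁⁅y⁆⇒x≡y : ∀ {n} {x y : Fin n} → x ∉ ∁ ⁅ y ⁆ → x ≡ y
x∉∁⁅y⁆⇒x≡y {y = y} = x∈⁅y⁆⇒x≡y y ∘ x∉∁p⇒x∈p

¬¬-bind : ∀ {a b} {A : Set a} {B : Set b} → ¬ ¬ A → (A → ¬ ¬ B) → ¬ ¬ B
¬¬-bind ¬¬a f ¬b = ¬¬a λ a → f a ¬b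

¬¬-decidable : ∀ {p} n (P : Fin n → Set p) → ¬ ¬ (∀ i → Dec (P i))
¬¬-decidable zero    P k = k λ ()
¬¬-decidable (suc n) P k = ¬¬-excluded-middle λ P0? →
  ¬¬-decidable n (P ∘ suc) λ P? → k λ { zero → P0? ; (suc i) → P? i }

all-or-counterexample : ∀ {p} n {P : Fin n → Set p} → (∀ i → Dec (P i)) →
                        (∀ i → P i) ⊎ ∃[ i ] ¬ P i
all-or-counterexample n {P} P? with all? P?
... | yes all  = inj₁ all
... | no ¬all  = inj₂ (¬∀⟶∃¬ n P P? ¬all)

¬¬-all-or-counterexample : ∀ {p} n (P : Fin n → Set p) → ¬ ¬ ((∀ i → P i) ⊎ ∃[ i ] ¬ P i)
¬¬-all-or-counterexample n P = ¬¬-map (all-or-counterexample n) (¬¬-decidable n P)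

-- The parameter H is only there because Defs defines sum and det inside QuotientHyperfield K H.
module Summation {c ℓ h} (K : CommutativeRing c ℓ) (H : Pred (CommutativeRing.Carrier K) h) where
  open CommutativeRing K hiding (zero) renaming (refl to ≈-refl)
  open QuotientHyperfield K H using (sum)
  private module ∑ = SemiringSum semiring

  sum≡∑ : ∀ n (f : Fin n → Carrier) → sum n f ≡ ∑.sum f
  sum≡∑ zero    f = refl
  sum≡∑ (suc n) f = ≡.cong (f zero +_) (sum≡∑ n (f ∘ suc))

  sum-cong : ∀ n {f g : Fin n → Carrier} → (∀ i → f i ≈ g i) → sum n f ≈ sum n g
  sum-cong n {f} {g} f≈g rewrite sum≡∑ n f | sum≡∑ n g = ∑.sum-cong-≋ f≈g

  sum-zero : ∀ n {f : Fin n → Carrier} → (∀ i → f i ≈ 0#) → sum n f ≈ 0#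
  sum-zero n {f} f≈0 rewrite sum≡∑ n f = trans (∑.sum-cong-≋ f≈0) (∑.sum-replicate-zero n)

  sum-distrib-+ : ∀ n (f g : Fin n → Carrier) →
                  sum n (λ i → f i + g i) ≈ sum n f + sum n g
  sum-distrib-+ n f g
    rewrite sum≡∑ n (λ i → f i + g i) | sum≡∑ n f | sum≡∑ n g = ∑.∑-distrib-+ f g

  *-distribˡ-sum : ∀ n x (f : Fin n → Carrier) → x * sum n f ≈ sum n (λ i → x * f i)
  *-distribˡ-sum n x f rewrite sum≡∑ n f | sum≡∑ n (λ i → x * f i) = ∑.*-distribˡ-sum x f

  sum-comm : ∀ m n (f : Fin m → Fin n → Carrier) →
             sum m (λ i → sum n (f i)) ≈ sum n (λ j → sum m (λ i → f i j))
  sum-comm m n f = begin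
    sum m (λ i → sum n (f i))         ≡⟨ sum≡∑ m _ ⟩
    ∑.sum (λ i → sum n (f i))         ≈⟨ ∑.sum-cong-≋ (λ i → reflexive (sum≡∑ n (f i))) ⟩
    ∑.sum (λ i → ∑.sum (f i))         ≈⟨ ∑.∑-comm f ⟩
    ∑.sum (λ j → ∑.sum (λ i → f i j)) ≈⟨ ∑.sum-cong-≋ (λ j → reflexive (≡.sym (sum≡∑ m (λ i → f i j)))) ⟩
    ∑.sum (λ j → sum m (λ i → f i j)) ≡⟨ ≡.sym (sum≡∑ n _) ⟩
    sum n (λ j → sum m (λ i → f i j)) ∎
    where open import Relation.Binary.Reasoning.Setoid setoid

  sum-remove : ∀ n (f : Fin (suc n) → Carrier) i → sum (suc n) f ≈ f i + sum n (f ∘ punchIn i)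
  sum-remove n f i rewrite sum≡∑ (suc n) f | sum≡∑ n (f ∘ punchIn i) = ∑.sum-remove f

  sum-single : ∀ n (f : Fin (suc n) → Carrier) i → (∀ j → j ≢ i → f j ≈ 0#) →
               sum (suc n) f ≈ f i
  sum-single n f i off = trans (sum-remove n f i)
    (trans (+-congˡ (sum-zero n (λ j → off (punchIn i j) (punchInᵢ≢i i j)))) (+-identityʳ _))

  sum-pair : ∀ n (f : Fin (suc n) → Carrier) {i j} → i ≢ j →
             (∀ k → k ≢ i → k ≢ j → f k ≈ 0#) → sum (suc n) f ≈ f i + f j
  sum-pair zero    f {zero} {zero} i≢j _ = ⊥-elim (i≢j refl)
  sum-pair (suc n) f {i} {j} i≢j off = trans (sum-remove (suc n) f i) (+-congˡ (trans
    (sum-single n (f ∘ punchIn i) (punchOut i≢j) λ k k≢ →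
       off (punchIn i k) (punchInᵢ≢i i k) (k≢ ∘ punchIn-cancel k))
    (reflexive (≡.cong f (punchIn-punchOut i≢j)))))
    where
    punchIn-cancel : ∀ k → punchIn i k ≡ j → k ≡ punchOut i≢j
    punchIn-cancel k eq = punchIn-injective i k _
      (≡.trans eq (≡.sym (punchIn-punchOut i≢j)))

module Determinant {c ℓ h} (K : CommutativeRing c ℓ) (H : Pred (CommutativeRing.Carrier K) h) where
  open CommutativeRing K hiding (zero) renaming (refl to ≈-refl)
  open RingProperties ring using (-‿distribˡ-*; -‿involutive; -0#≈0#; +-inverseʳ-unique)
  open CommutativeSemigroupProperties *-commutativeSemigroup using (x∙yz≈y∙xz)
  open QuotientHyperfield K H using (sum; sgn; det)
  open Summation K H
  open import Relation.Binary.Reasoning.Setoid setoid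

  Matrix : ℕ → Set c
  Matrix n = Fin n → Fin n → Carrier

  minor : ∀ {n} → Matrix (suc n) → Fin (suc n) → Matrix n
  minor A j r s = A (suc r) (punchIn j s)

  expansionTerm : ∀ {n} → Matrix (suc n) → Fin (suc n) → Carrier
  expansionTerm {n} A j = sgn (toℕ j) * A zero j * det n (minor A j)

  replaceColumn : ∀ {n} → Matrix n → Fin n → (Fin n → Carrier) → Matrix n
  replaceColumn A p u r = updateAt (A r) p (λ _ → u r)

  det-cong : ∀ n {A B : Matrix n} → (∀ r s → A r s ≈ B r s) → det n A ≈ det n B
  det-cong zero    A≈B = ≈-refl
  det-cong (suc n) A≈B = sum-cong (suc n) λ j →
    *-cong (*-congˡ {sgn (toℕ j)} (A≈B zero j)) (det-cong n λ r s → A≈B (suc r) (punchIn j s))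

  expansionTerm-linear-at : ∀ n (A A₁ A₂ : Matrix (suc n)) p k →
    (∀ r → A r p ≈ A₁ r p + k * A₂ r p) →
    (∀ r s → s ≢ p → A r s ≈ A₁ r s) → (∀ r s → s ≢ p → A r s ≈ A₂ r s) →
    expansionTerm A p ≈ expansionTerm A₁ p + k * expansionTerm A₂ p
  expansionTerm-linear-at n A A₁ A₂ p k at-p off₁ off₂ = begin
    s * A zero p * det n (minor A p)
      ≈⟨ *-cong (*-congˡ (at-p zero)) (det-cong n λ r t → off₁ (suc r) _ (punchInᵢ≢i p t)) ⟩
    s * (A₁ zero p + k * A₂ zero p) * d
      ≈⟨ *-congʳ (distribˡ s _ _) ⟩
    (s * A₁ zero p + s * (k * A₂ zero p)) * d
      ≈⟨ distribʳ d _ _ ⟩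
    s * A₁ zero p * d + s * (k * A₂ zero p) * d
      ≈⟨ +-congˡ (trans (*-congʳ (x∙yz≈y∙xz s k _)) (*-assoc k _ d)) ⟩
    s * A₁ zero p * d + k * (s * A₂ zero p * d)
      ≈⟨ +-congˡ (*-congˡ (*-congˡ (det-cong n λ r t →
           trans (sym (off₁ (suc r) _ (punchInᵢ≢i p t))) (off₂ (suc r) _ (punchInᵢ≢i p t))))) ⟩
    expansionTerm A₁ p + k * expansionTerm A₂ p ∎
    where
    s = sgn (toℕ p)
    d = det n (minor A₁ p)

  det-linear-column : ∀ n (A A₁ A₂ : Matrix n) p k →
    (∀ r → A r p ≈ A₁ r p + k * A₂ r p) →
    (∀ r s → s ≢ p → A r s ≈ A₁ r s) → (∀ r s → s ≢ p → A r s ≈ A₂ r s) →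
    det n A ≈ det n A₁ + k * det n A₂
  det-linear-column (suc n) A A₁ A₂ p k at-p off₁ off₂ = begin
    sum (suc n) (expansionTerm A)
      ≈⟨ sum-cong (suc n) term-linear ⟩
    sum (suc n) (λ j → expansionTerm A₁ j + k * expansionTerm A₂ j)
      ≈⟨ sum-distrib-+ (suc n) (expansionTerm A₁) (λ j → k * expansionTerm A₂ j) ⟩
    det (suc n) A₁ + sum (suc n) (λ j → k * expansionTerm A₂ j)
      ≈⟨ +-congˡ (sym (*-distribˡ-sum (suc n) k (expansionTerm A₂))) ⟩
    det (suc n) A₁ + k * det (suc n) A₂ ∎
    where
    term-linear : ∀ j → expansionTerm A j ≈ expansionTerm A₁ j + k * expansionTerm A₂ j
    term-linear j with j ≟ p
    ... | yes refl = expansionTerm-linear-at n A A₁ A₂ j k at-p off₁ off₂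
    ... | no j≢p = begin
      s * A zero j * det n (minor A j)
        ≈⟨ *-congˡ (det-linear-column n (minor A j) (minor A₁ j) (minor A₂ j) p′ k at-p′
                      (λ r t t≢ → off₁ (suc r) _ (moved t t≢))
                      (λ r t t≢ → off₂ (suc r) _ (moved t t≢))) ⟩
      s * A zero j * (det n (minor A₁ j) + k * det n (minor A₂ j))
        ≈⟨ distribˡ _ _ _ ⟩
      s * A zero j * det n (minor A₁ j) + s * A zero j * (k * det n (minor A₂ j))
        ≈⟨ +-cong (*-congʳ (*-congˡ (off₁ zero j j≢p)))
                  (trans (x∙yz≈y∙xz _ k _) (*-congˡ (*-congʳ (*-congˡ (off₂ zero j j≢p))))) ⟩
      expansionTerm A₁ j + k * expansionTerm A₂ j ∎
      where
      s = sgn (toℕ j)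
      p′ = punchOut j≢p
      at-p′ : ∀ r → minor A j r p′ ≈ minor A₁ j r p′ + k * minor A₂ j r p′
      at-p′ r = ≡.subst (λ x → A (suc r) x ≈ A₁ (suc r) x + k * A₂ (suc r) x)
                  (≡.sym (punchIn-punchOut j≢p)) (at-p (suc r))
      moved : ∀ t → t ≢ p′ → punchIn j t ≢ p
      moved t t≢p′ eq = t≢p′ (punchIn-injective j t p′ (≡.trans eq (≡.sym (punchIn-punchOut j≢p))))

  det-linear-replaceColumn : ∀ n (A : Matrix n) p {w} (u v : Fin n → Carrier) k →
    (∀ r → w r ≈ u r + k * v r) →
    det n (replaceColumn A p w) ≈ det n (replaceColumn A p u) + k * det n (replaceColumn A p v)
  det-linear-replaceColumn n A p u v k w≈ = det-linear-column n _ _ _ p k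
    (λ r → trans (reflexive (updateAt-updates p (A r))) (trans (w≈ r)
             (reflexive (≡.sym (≡.cong₂ (λ x y → x + k * y) (updateAt-updates p (A r)) (updateAt-updates p (A r)))))))
    (λ r s s≢p → reflexive (≡.trans (updateAt-minimal s p (A r) s≢p) (≡.sym (updateAt-minimal s p (A r) s≢p))))
    (λ r s s≢p → reflexive (≡.trans (updateAt-minimal s p (A r) s≢p) (≡.sym (updateAt-minimal s p (A r) s≢p))))

  det-additive-replaceColumn : ∀ n (A : Matrix n) p (u v : Fin n → Carrier) →
    det n (replaceColumn A p (λ r → u r + v r)) ≈ det n (replaceColumn A p u) + det n (replaceColumn A p v)
  det-additive-replaceColumn n A p u v =
    trans (det-linear-replaceColumn n A p u v 1# (λ r → +-congˡ (sym (*-identityˡ _)))) (+-congˡ (*-identityˡ _))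

  det-adjacent-equal-columns : ∀ n (A : Matrix (suc n)) i →
    (∀ r → A r (inject₁ i) ≈ A r (suc i)) → det (suc n) A ≈ 0#
  det-adjacent-equal-columns (suc n) A i equal = begin
    det (suc (suc n)) A                    ≈⟨ sum-pair (suc n) (expansionTerm A) p≢q others ⟩
    expansionTerm A p + expansionTerm A q  ≈⟨ +-congˡ q-term ⟩
    expansionTerm A p + - expansionTerm A p ≈⟨ -‿inverseʳ _ ⟩
    0# ∎
    where
    p = inject₁ i
    q = suc i
    p≢q = inject₁≢suc i
    others : ∀ j → j ≢ p → j ≢ q → expansionTerm A j ≈ 0#
    others j j≢p j≢q with punchIn-adjacent j i j≢p j≢q
    ... | i′ , p′ , q′ = trans (*-congˡ (det-adjacent-equal-columns n (minor A j) i′ λ r →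
            ≡.subst₂ (λ x y → A (suc r) x ≈ A (suc r) y) (≡.sym p′) (≡.sym q′) (equal (suc r))))
          (zeroʳ _)
    same-minor : ∀ r s → minor A q r s ≈ minor A p r s
    same-minor r s with s ≟ i
    ... | yes refl = ≡.subst₂ (λ x y → A (suc r) x ≈ A (suc r) y)
                       (≡.sym (punchIn-suc-self s)) (≡.sym (punchIn-inject₁-self s)) (equal (suc r))
    ... | no s≢i = reflexive (≡.cong (A (suc r)) (punchIn-suc≡punchIn-inject₁ i s s≢i))
    q-term : expansionTerm A q ≈ - expansionTerm A p
    q-term = begin
      - sgn (toℕ i) * A zero q * det (suc n) (minor A q)
        ≈⟨ *-cong (*-cong (-‿cong (reflexive (≡.cong sgn (≡.sym (toℕ-inject₁ i))))) (sym (equal zero)))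
                  (det-cong (suc n) same-minor) ⟩
      - sgn (toℕ p) * A zero p * det (suc n) (minor A p)
        ≈⟨ *-congʳ (sym (-‿distribˡ-* _ _)) ⟩
      - (sgn (toℕ p) * A zero p) * det (suc n) (minor A p)
        ≈⟨ sym (-‿distribˡ-* _ _) ⟩
      - expansionTerm A p ∎

  swapColumns : ∀ {n} → Matrix n → Fin n → Fin n → Matrix n
  swapColumns A p q = replaceColumn (replaceColumn A p (λ r → A r q)) q (λ r → A r p)

  swapColumns-first : ∀ {n} (A : Matrix n) {p q} → p ≢ q → ∀ r → swapColumns A p q r p ≡ A r q
  swapColumns-first A {p} {q} p≢q r = ≡.trans (updateAt-minimal p q _ p≢q) (updateAt-updates p (A r))

  swapColumns-other : ∀ {n} (A : Matrix n) p q r s → s ≢ p → s ≢ q → swapColumns A p q r s ≡ A r s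
  swapColumns-other A p q r s s≢p s≢q =
    ≡.trans (updateAt-minimal s q _ s≢q) (updateAt-minimal s p (A r) s≢p)

  -- Expand det W(a+b, a+b) = 0 by additivity in both columns, where W u v puts u and v in columns p and q.
  det-swap-adjacent-columns : ∀ n (A : Matrix (suc n)) i →
    det (suc n) (swapColumns A (inject₁ i) (suc i)) ≈ - det (suc n) A
  det-swap-adjacent-columns n A i = +-inverseʳ-unique _ _ (begin
    det (suc n) A + D b a           ≈⟨ +-congʳ (det-cong (suc n) unchanged) ⟨
    D a b + D b a                   ≈⟨ +-cong (+-identityˡ _) (+-identityʳ _) ⟨
    (0# + D a b) + (D b a + 0#)     ≈⟨ +-cong (+-congʳ (same a)) (+-congˡ (same b)) ⟨
    (D a a + D a b) + (D b a + D b b) ≈⟨ +-cong (additive-q a a b) (additive-q b a b) ⟨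
    D a (a ⊕ b) + D b (a ⊕ b)       ≈⟨ additive-p a b (a ⊕ b) ⟨
    D (a ⊕ b) (a ⊕ b)               ≈⟨ same (a ⊕ b) ⟩
    0# ∎)
    where
    p = inject₁ i
    q = suc i
    q≢p : q ≢ p
    q≢p = inject₁≢suc i ∘ ≡.sym
    a b : Fin (suc n) → Carrier
    a r = A r p
    b r = A r q
    _⊕_ : (Fin (suc n) → Carrier) → (Fin (suc n) → Carrier) → Fin (suc n) → Carrier
    (u ⊕ v) r = u r + v r
    W : (Fin (suc n) → Carrier) → (Fin (suc n) → Carrier) → Matrix (suc n)
    W u v = replaceColumn (replaceColumn A p u) q v
    D : (Fin (suc n) → Carrier) → (Fin (suc n) → Carrier) → Carrier
    D u v = det (suc n) (W u v)
    additive-q : ∀ u v₁ v₂ → D u (v₁ ⊕ v₂) ≈ D u v₁ + D u v₂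
    additive-q u = det-additive-replaceColumn (suc n) (replaceColumn A p u) q
    commute : ∀ u v r s → W u v r s ≈ replaceColumn (replaceColumn A q v) p u r s
    commute u v r s = reflexive (updateAt-commutes q p q≢p (A r) s)
    additive-p : ∀ u₁ u₂ v → D (u₁ ⊕ u₂) v ≈ D u₁ v + D u₂ v
    additive-p u₁ u₂ v = trans (det-cong (suc n) (commute (u₁ ⊕ u₂) v))
      (trans (det-additive-replaceColumn (suc n) (replaceColumn A q v) p u₁ u₂)
             (sym (+-cong (det-cong (suc n) (commute u₁ v)) (det-cong (suc n) (commute u₂ v)))))
    unchanged : ∀ r s → W a b r s ≈ A r s
    unchanged r s = reflexive (≡.trans (updateAt-id-local q _ (≡.sym (inner q)) s) (inner s))
      where inner = updateAt-id-local p (A r) refl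
    same : ∀ u → D u u ≈ 0#
    same u = det-adjacent-equal-columns n (W u u) i λ r →
      reflexive (≡.trans (updateAt-minimal p q _ (q≢p ∘ ≡.sym))
                (≡.trans (updateAt-updates p (A r)) (≡.sym (updateAt-updates q (replaceColumn A p u r)))))

  det-equal-columns-at : ∀ d {n} (A : Matrix n) p q → suc (toℕ p ℕ.+ d) ≡ toℕ q →
                         (∀ r → A r p ≈ A r q) → det n A ≈ 0#
  det-equal-columns-at zero {suc n} A p (suc i) dist equal =
    det-adjacent-equal-columns n A i λ r → ≡.subst (λ x → A r x ≈ A r (suc i)) p≡i (equal r)
    where
    p≡i : p ≡ inject₁ i
    p≡i = toℕ-injective (≡.trans (≡.trans (≡.sym (ℕₚ.+-identityʳ (toℕ p))) (ℕₚ.suc-injective dist))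
                                 (≡.sym (toℕ-inject₁ i)))
  det-equal-columns-at (suc d) {suc n} A p (suc i) dist equal = begin
    det (suc n) A       ≈⟨ -‿involutive _ ⟨
    - - det (suc n) A   ≈⟨ -‿cong (det-swap-adjacent-columns n A i) ⟨
    - det (suc n) B     ≈⟨ -‿cong (det-equal-columns-at d B p (inject₁ i) dist′ equal′) ⟩
    - 0#                ≈⟨ -0#≈0# ⟩
    0# ∎
    where
    B = swapColumns A (inject₁ i) (suc i)
    dist′ : suc (toℕ p ℕ.+ d) ≡ toℕ (inject₁ i)
    dist′ = ≡.trans (≡.sym (ℕₚ.+-suc (toℕ p) d)) (≡.trans (ℕₚ.suc-injective dist) (≡.sym (toℕ-inject₁ i)))
    p≢i : p ≢ inject₁ i
    p≢i eq = ℕₚ.m≢1+m+n (toℕ p) (≡.trans (≡.cong toℕ eq) (≡.sym dist′))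
    p≢1+i : p ≢ suc i
    p≢1+i eq = ℕₚ.m≢1+m+n (toℕ p) (≡.trans (≡.cong toℕ eq) (≡.sym dist))
    equal′ : ∀ r → B r p ≈ B r (inject₁ i)
    equal′ r = trans (reflexive (swapColumns-other A _ _ r p p≢i p≢1+i))
                     (trans (equal r) (reflexive (≡.sym (swapColumns-first A (inject₁≢suc i) r))))

  det-equal-columns : ∀ n (A : Matrix n) {p q} → p ≢ q → (∀ r → A r p ≈ A r q) → det n A ≈ 0#
  det-equal-columns n A {p} {q} p≢q equal with <-cmpᶠ p q
  ... | tri< p<q _ _ = let d , dist = ℕₚ.m≤n⇒∃[o]m+o≡n p<q in det-equal-columns-at d A p q dist equal
  ... | tri≈ _ p≡q _ = ⊥-elim (p≢q p≡q)
  ... | tri> _ _ q<p = let d , dist = ℕₚ.m≤n⇒∃[o]m+o≡n q<p in det-equal-columns-at d A q p dist (sym ∘ equal)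

  det-add-column-multiple : ∀ n (A : Matrix n) {j p} → j ≢ p → ∀ k →
    det n (replaceColumn A j (λ r → A r j + k * A r p)) ≈ det n A
  det-add-column-multiple n A {j} {p} j≢p k = begin
    det n (replaceColumn A j (λ r → A r j + k * A r p))
      ≈⟨ det-linear-replaceColumn n A j (λ r → A r j) (λ r → A r p) k (λ r → ≈-refl) ⟩
    det n (replaceColumn A j (λ r → A r j)) + k * det n (replaceColumn A j (λ r → A r p))
      ≈⟨ +-cong (det-cong n λ r s → reflexive (updateAt-id-local j (A r) refl s))
                (*-congˡ (det-equal-columns n _ j≢p λ r →
                   reflexive (≡.trans (updateAt-updates j (A r)) (≡.sym (updateAt-minimal p j (A r) (j≢p ∘ ≡.sym)))))) ⟩
    det n A + k * 0#  ≈⟨ +-congˡ (zeroʳ k) ⟩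
    det n A + 0#      ≈⟨ +-identityʳ _ ⟩
    det n A ∎

  columnOp : ∀ {n} → Matrix n → Fin n → (Fin n → Carrier) → Matrix n
  columnOp A p t r s = A r s + t s * A r p

  columnOp-cong : ∀ {n} (A : Matrix n) p {t t′} → (∀ s → t s ≈ t′ s) →
                  ∀ r s → columnOp A p t r s ≈ columnOp A p t′ r s
  columnOp-cong A p t≈t′ r s = +-congˡ (*-congʳ (t≈t′ s))

  columnOp-unchanged : ∀ {n} (A : Matrix n) p {t} r {s} → t s ≈ 0# → columnOp A p t r s ≈ A r s
  columnOp-unchanged A p r ts≈0 = trans (+-congˡ (trans (*-congʳ ts≈0) (zeroˡ _))) (+-identityʳ _)

  det-columnOp-update : ∀ n (A : Matrix n) p t j → t p ≈ 0# →
    det n (columnOp A p t) ≈ det n (columnOp A p (updateAt t j (λ _ → 0#)))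
  det-columnOp-update n A p t j tp≈0 with j ≟ p
  ... | yes refl = det-cong n (columnOp-cong A p t≈t′)
    where
    t≈t′ : ∀ s → t s ≈ updateAt t j (λ _ → 0#) s
    t≈t′ s with s ≟ j
    ... | yes refl = trans tp≈0 (reflexive (≡.sym (updateAt-updates s t)))
    ... | no s≢j = reflexive (≡.sym (updateAt-minimal s j t s≢j))
  ... | no j≢p = trans (det-cong n split) (det-add-column-multiple n B j≢p (t j))
    where
    t′ = updateAt t j (λ _ → 0#)
    B = columnOp A p t′
    B-p : ∀ r → B r p ≈ A r p
    B-p r = columnOp-unchanged A p {t′} r (trans (reflexive (updateAt-minimal p j t (j≢p ∘ ≡.sym))) tp≈0)
    split : ∀ r s → columnOp A p t r s ≈ replaceColumn B j (λ r → B r j + t j * B r p) r s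
    split r s with s ≟ j
    ... | yes refl = trans (+-cong (sym (columnOp-unchanged A p {t′} r (reflexive (updateAt-updates s t))))
                                  (*-congˡ (sym (B-p r))))
                           (reflexive (≡.sym (updateAt-updates s (B r))))
    ... | no s≢j = trans (+-congˡ (*-congʳ (reflexive (≡.sym (updateAt-minimal s j t s≢j)))))
                         (reflexive (≡.sym (updateAt-minimal s j (B r) s≢j)))

  det-columnOp : ∀ n (A : Matrix n) p t → t p ≈ 0# → det n (columnOp A p t) ≈ det n A
  det-columnOp n A p t tp≈0 = go (allFin n) t tp≈0 λ s s∉ → ⊥-elim (s∉ (∈-allFin s))
    where
    go : ∀ js t → t p ≈ 0# → (∀ s → s ∉ᴸ js → t s ≈ 0#) → det n (columnOp A p t) ≈ det n A
    go []       t _     vanish = det-cong n λ r s → columnOp-unchanged A p {t} r (vanish s λ ())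
    go (j ∷ js) t tp≈0 vanish = trans (det-columnOp-update n A p t j tp≈0)
      (go js (updateAt t j (λ _ → 0#)) (cleared p λ _ → tp≈0) λ s s∉js → cleared s λ s≢j →
         vanish s λ { (here s≡j) → s≢j s≡j ; (there s∈js) → s∉js s∈js })
      where
      cleared : ∀ s → (s ≢ j → t s ≈ 0#) → updateAt t j (λ _ → 0#) s ≈ 0#
      cleared s ts≈0 with s ≟ j
      ... | yes refl = reflexive (updateAt-updates s t)
      ... | no s≢j   = trans (reflexive (updateAt-minimal s j t s≢j)) (ts≈0 s≢j)

module FieldProperties {c ℓ} (K : CommutativeRing c ℓ) (isField : IsField K) where
  open CommutativeRing K hiding (zero) renaming (refl to ≈-refl)
  open import Relation.Binary.Reasoning.Setoid setoid

  1≉0 : ¬ 1# ≈ 0#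
  1≉0 1≈0 = proj₁ isField (sym 1≈0)

  _⁻¹⟨_⟩ : ∀ x → ¬ x ≈ 0# → Carrier
  x ⁻¹⟨ x≉0 ⟩ = proj₁ (proj₂ isField x x≉0)

  x*x⁻¹≈1 : ∀ x (x≉0 : ¬ x ≈ 0#) → x * x ⁻¹⟨ x≉0 ⟩ ≈ 1#
  x*x⁻¹≈1 x x≉0 = proj₂ (proj₂ isField x x≉0)

  x⁻¹*x≈1 : ∀ x (x≉0 : ¬ x ≈ 0#) → x ⁻¹⟨ x≉0 ⟩ * x ≈ 1#
  x⁻¹*x≈1 x x≉0 = trans (*-comm _ x) (x*x⁻¹≈1 x x≉0)

  x*[x⁻¹*y]≈y : ∀ x (x≉0 : ¬ x ≈ 0#) y → x * (x ⁻¹⟨ x≉0 ⟩ * y) ≈ y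
  x*[x⁻¹*y]≈y x x≉0 y = trans (sym (*-assoc _ _ y)) (trans (*-congʳ (x*x⁻¹≈1 x x≉0)) (*-identityˡ y))

  x⁻¹*[x*y]≈y : ∀ x (x≉0 : ¬ x ≈ 0#) y → x ⁻¹⟨ x≉0 ⟩ * (x * y) ≈ y
  x⁻¹*[x*y]≈y x x≉0 y = trans (sym (*-assoc _ x y)) (trans (*-congʳ (x⁻¹*x≈1 x x≉0)) (*-identityˡ y))

  *-cancelˡ : ∀ {x y z} → ¬ x ≈ 0# → x * y ≈ x * z → y ≈ z
  *-cancelˡ {x} {y} {z} x≉0 xy≈xz = begin
    y                  ≈⟨ x⁻¹*[x*y]≈y x x≉0 y ⟨
    x ⁻¹⟨ x≉0 ⟩ * (x * y) ≈⟨ *-congˡ xy≈xz ⟩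
    x ⁻¹⟨ x≉0 ⟩ * (x * z) ≈⟨ x⁻¹*[x*y]≈y x x≉0 z ⟩
    z ∎

  x*y≈0⇒y≈0 : ∀ {x y} → ¬ x ≈ 0# → x * y ≈ 0# → y ≈ 0#
  x*y≈0⇒y≈0 {x} x≉0 xy≈0 = *-cancelˡ x≉0 (trans xy≈0 (sym (zeroʳ x)))

  *-nonzero : ∀ {x y} → ¬ x ≈ 0# → ¬ y ≈ 0# → ¬ x * y ≈ 0#
  *-nonzero x≉0 y≉0 xy≈0 = y≉0 (x*y≈0⇒y≈0 x≉0 xy≈0)

  ⁻¹-nonzero : ∀ x (x≉0 : ¬ x ≈ 0#) → ¬ x ⁻¹⟨ x≉0 ⟩ ≈ 0#
  ⁻¹-nonzero x x≉0 x⁻¹≈0 = 1≉0 (trans (sym (x*x⁻¹≈1 x x≉0)) (trans (*-congˡ x⁻¹≈0) (zeroʳ x)))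

  -‿nonzero : ∀ {x} → ¬ x ≈ 0# → ¬ - x ≈ 0#
  -‿nonzero {x} x≉0 -x≈0 = x≉0 (begin
    x        ≈⟨ -‿involutive x ⟨
    - - x    ≈⟨ -‿cong -x≈0 ⟩
    - 0#     ≈⟨ -0#≈0# ⟩
    0#       ∎)
    where open RingProperties ring using (-‿involutive; -0#≈0#)

module Elimination {c ℓ h} (K : CommutativeRing c ℓ) (isField : IsField K)
                   (H : Pred (CommutativeRing.Carrier K) h) where
  open CommutativeRing K hiding (zero) renaming (refl to ≈-refl)
  open RingProperties ring using (-‿distribˡ-*; -‿distribʳ-*; -0#≈0#)
  open CommutativeSemigroupProperties +-commutativeSemigroup using () renaming (x∙yz≈y∙xz to x+[y+z]≈y+[x+z])
  open QuotientHyperfield K H using (sum; sgn; det; Nonsingular; transpose)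
  open Summation K H
  open Determinant K H
  open FieldProperties K isField
  open import Relation.Binary.Reasoning.Setoid setoid

  mulVec : ∀ {m n} → (Fin m → Fin n → Carrier) → (Fin n → Carrier) → Fin m → Carrier
  mulVec {n = n} A v i = sum n (λ j → A i j * v j)

  Kernel : ∀ {m n} → (Fin m → Fin n → Carrier) → (Fin n → Carrier) → Set ℓ
  Kernel A v = ∀ i → mulVec A v i ≈ 0#

  HasKernel : ∀ {m n} → (Fin m → Fin n → Carrier) → Set (c ⊔ ℓ)
  HasKernel {n = n} A = Σ (Fin n → Carrier) λ v → (∃[ j ] ¬ v j ≈ 0#) × Kernel A v

  KernelTrivial : ∀ {m n} → (Fin m → Fin n → Carrier) → Set (c ⊔ ℓ)
  KernelTrivial A = ∀ v → Kernel A v → ∀ j → v j ≈ 0#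

  ColumnsSpan : ∀ {m n} → (Fin m → Fin n → Carrier) → Set (c ⊔ ℓ)
  ColumnsSpan {m} {n} A = ∀ (y : Fin m → Carrier) → Σ (Fin n → Carrier) λ x → ∀ i → mulVec A x i ≈ y i

  -- Regular asks for spanning columns rather than independent rows: that is what the
  -- zero-first-row case of the elimination needs, and it excludes row dependencies.
  Regular : ∀ {n} → Matrix n → Set (c ⊔ ℓ)
  Regular A = Nonsingular A × KernelTrivial A × ColumnsSpan A

  Singular : ∀ {n} → Matrix n → Set (c ⊔ ℓ)
  Singular {n} A = det n A ≈ 0# × HasKernel A × HasKernel (transpose A)

  mulVec-cong : ∀ {m n} (A : Fin m → Fin n → Carrier) {u v} → (∀ j → u j ≈ v j) →
                ∀ i → mulVec A u i ≈ mulVec A v i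
  mulVec-cong {n = n} A u≈v i = sum-cong n λ j → *-congˡ (u≈v j)

  sgn≉0 : ∀ k → ¬ sgn k ≈ 0#
  sgn≉0 zero    = 1≉0
  sgn≉0 (suc k) = -‿nonzero (sgn≉0 k)

  unit : ∀ {n} → Fin n → Fin n → Carrier
  unit p = updateAt (λ _ → 0#) p (λ _ → 1#)

  unit-≡ : ∀ {n} (p : Fin n) → unit p p ≡ 1#
  unit-≡ p = updateAt-updates p _

  unit-≢ : ∀ {n} {p s : Fin n} → s ≢ p → unit p s ≡ 0#
  unit-≢ {p = p} {s} s≢p = updateAt-minimal s p _ s≢p

  sum-*-unit : ∀ n (f : Fin n → Carrier) p → sum n (λ s → f s * unit p s) ≈ f p
  sum-*-unit (suc n) f p = trans
    (sum-single n (λ s → f s * unit p s) p λ s s≢p → trans (*-congˡ {f s} (reflexive (unit-≢ s≢p))) (zeroʳ _))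
    (trans (*-congˡ {f p} (reflexive (unit-≡ p))) (*-identityʳ _))

  dot : ∀ {n} → (Fin n → Carrier) → (Fin n → Carrier) → Carrier
  dot {n} t u = sum n (λ s → t s * u s)

  displace : ∀ {n} → Fin n → Carrier → (Fin n → Carrier) → Fin n → Carrier
  displace p x u s = u s + x * unit p s

  shear : ∀ {n} → Fin n → (Fin n → Carrier) → (Fin n → Carrier) → Fin n → Carrier
  shear p t u = displace p (dot t u) u

  sum-*-displace : ∀ n (f u : Fin n → Carrier) p x →
    sum n (λ s → f s * displace p x u s) ≈ sum n (λ s → f s * u s) + f p * x
  sum-*-displace n f u p x = begin
    sum n (λ s → f s * (u s + x * unit p s))
      ≈⟨ sum-cong n (λ s → distribˡ (f s) _ _) ⟩
    sum n (λ s → f s * u s + f s * (x * unit p s))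
      ≈⟨ sum-distrib-+ n (λ s → f s * u s) (λ s → f s * (x * unit p s)) ⟩
    sum n (λ s → f s * u s) + sum n (λ s → f s * (x * unit p s))
      ≈⟨ +-congˡ (trans (sum-cong n λ s → sym (*-assoc (f s) x _)) (sum-*-unit n (λ s → f s * x) p)) ⟩
    sum n (λ s → f s * u s) + f p * x ∎

  dot-zero : ∀ {n} (t : Fin n → Carrier) {u} → (∀ s → u s ≈ 0#) → dot t u ≈ 0#
  dot-zero {n} t u≈0 = sum-zero n λ s → trans (*-congˡ (u≈0 s)) (zeroʳ (t s))

  displace-zero : ∀ {n} p {x} (u : Fin n → Carrier) → x ≈ 0# → ∀ s → displace p x u s ≈ u s
  displace-zero p u x≈0 s = trans (+-congˡ (trans (*-congʳ x≈0) (zeroˡ _))) (+-identityʳ _)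

  displace-displace : ∀ {n} p x y (u : Fin n → Carrier) s →
                      displace p y (displace p x u) s ≈ displace p (x + y) u s
  displace-displace p x y u s = trans (+-assoc _ _ _) (+-congˡ (sym (distribʳ _ x y)))

  dot-displace : ∀ {n} (t : Fin n → Carrier) {p} → t p ≈ 0# → ∀ x u → dot t (displace p x u) ≈ dot t u
  dot-displace {n} t {p} tp≈0 x u = trans (sum-*-displace n t u p x)
    (trans (+-congˡ (trans (*-congʳ tp≈0) (zeroˡ x))) (+-identityʳ _))

  mulVec-columnOp : ∀ {n} (A : Matrix n) p t u i → mulVec (columnOp A p t) u i ≈ mulVec A (shear p t u) i
  mulVec-columnOp {n} A p t u i = begin
    sum n (λ s → (A i s + t s * A i p) * u s)
      ≈⟨ sum-cong n (λ s → trans (distribʳ (u s) _ _)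
                                 (+-congˡ (trans (*-congʳ (*-comm (t s) _)) (*-assoc _ (t s) (u s))))) ⟩
    sum n (λ s → A i s * u s + A i p * (t s * u s))
      ≈⟨ sum-distrib-+ n (λ s → A i s * u s) (λ s → A i p * (t s * u s)) ⟩
    mulVec A u i + sum n (λ s → A i p * (t s * u s))
      ≈⟨ +-congˡ (sym (*-distribˡ-sum n (A i p) (λ s → t s * u s))) ⟩
    mulVec A u i + A i p * dot t u
      ≈⟨ sum-*-displace n (A i) u p (dot t u) ⟨
    mulVec A (shear p t u) i ∎

  mulVecᵀ-columnOp : ∀ {n} (A : Matrix n) p t w j →
    mulVec (transpose (columnOp A p t)) w j ≈ mulVec (transpose A) w j + t j * mulVec (transpose A) w p
  mulVecᵀ-columnOp {n} A p t w j = begin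
    sum n (λ i → (A i j + t j * A i p) * w i)
      ≈⟨ sum-cong n (λ i → trans (distribʳ (w i) _ _) (+-congˡ (*-assoc (t j) _ (w i)))) ⟩
    sum n (λ i → A i j * w i + t j * (A i p * w i))
      ≈⟨ sum-distrib-+ n (λ i → A i j * w i) (λ i → t j * (A i p * w i)) ⟩
    mulVec (transpose A) w j + sum n (λ i → t j * (A i p * w i))
      ≈⟨ +-congˡ (sym (*-distribˡ-sum n (t j) (λ i → A i p * w i))) ⟩
    mulVec (transpose A) w j + t j * mulVec (transpose A) w p ∎

  module ColumnOperation {n} (A : Matrix n) (p : Fin n) (t : Fin n → Carrier) (tp≈0 : t p ≈ 0#) where
    unshear : (Fin n → Carrier) → Fin n → Carrier
    unshear v = displace p (- dot t v) v

    shear-unshear : ∀ v s → shear p t (unshear v) s ≈ v s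
    shear-unshear v s = trans (displace-displace p _ _ v s) (displace-zero p v (begin
      - dot t v + dot t (unshear v) ≈⟨ +-congˡ (dot-displace t tp≈0 _ v) ⟩
      - dot t v + dot t v           ≈⟨ -‿inverseˡ _ ⟩
      0#                            ∎) s)

    unshear-shear : ∀ u s → unshear (shear p t u) s ≈ u s
    unshear-shear u s = trans (displace-displace p _ _ u s) (displace-zero p u (begin
      dot t u + - dot t (shear p t u) ≈⟨ +-congˡ (-‿cong (dot-displace t tp≈0 _ u)) ⟩
      dot t u + - dot t u             ≈⟨ -‿inverseʳ _ ⟩
      0#                              ∎) s)

    unshear-zero : ∀ v → (∀ s → v s ≈ 0#) → ∀ s → unshear v s ≈ 0#
    unshear-zero v v≈0 s =
      trans (displace-zero p v (trans (-‿cong (dot-zero t v≈0)) -0#≈0#) s) (v≈0 s)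

    kernelTrivial : KernelTrivial (columnOp A p t) → KernelTrivial A
    kernelTrivial trivial v Av≈0 j =
      trans (sym (shear-unshear v j)) (trans (displace-zero p u (dot-zero t u≈0) j) (u≈0 j))
      where
      u = unshear v
      u≈0 : ∀ s → u s ≈ 0#
      u≈0 = trivial u λ i → trans (mulVec-columnOp A p t u i) (trans (mulVec-cong A (shear-unshear v) i) (Av≈0 i))

    columnsSpan : ColumnsSpan (columnOp A p t) → ColumnsSpan A
    columnsSpan span y with span y
    ... | x , Bx≈y = shear p t x , λ i → trans (sym (mulVec-columnOp A p t x i)) (Bx≈y i)

    regular : Regular (columnOp A p t) → Regular A
    regular (nonsingular , trivial , span) =
      (λ detA≈0 → nonsingular (trans (det-columnOp n A p t tp≈0) detA≈0)) ,
      kernelTrivial trivial , columnsSpan span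

    -- shear p t is invertible, so shear p t u ≠ 0, but a nonzero entry can only be located ¬¬.
    hasKernel : HasKernel (columnOp A p t) → ¬ ¬ HasKernel A
    hasKernel (u , (j , uj≉0) , Bu≈0) = ¬¬-map witness (¬¬-all-or-counterexample n λ s → shear p t u s ≈ 0#)
      where
      Av≈0 : Kernel A (shear p t u)
      Av≈0 i = trans (sym (mulVec-columnOp A p t u i)) (Bu≈0 i)
      witness : (∀ s → shear p t u s ≈ 0#) ⊎ ∃[ s ] ¬ shear p t u s ≈ 0# → HasKernel A
      witness (inj₁ v≈0) = ⊥-elim (uj≉0 (trans (sym (unshear-shear u j)) (unshear-zero _ v≈0 j)))
      witness (inj₂ nonzero) = shear p t u , nonzero , Av≈0

    hasKernelᵀ : HasKernel (transpose (columnOp A p t)) → HasKernel (transpose A)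
    hasKernelᵀ (w , nonzero , Bᵀw≈0) = w , nonzero , Aᵀw≈0
      where
      Aᵀw-p≈0 : mulVec (transpose A) w p ≈ 0#
      Aᵀw-p≈0 = trans (sym (trans (+-congˡ (trans (*-congʳ tp≈0) (zeroˡ _))) (+-identityʳ _)))
                      (trans (sym (mulVecᵀ-columnOp A p t w p)) (Bᵀw≈0 p))
      Aᵀw≈0 : Kernel (transpose A) w
      Aᵀw≈0 j = trans (sym (trans (+-congˡ (trans (*-congˡ Aᵀw-p≈0) (zeroʳ _))) (+-identityʳ _)))
                      (trans (sym (mulVecᵀ-columnOp A p t w j)) (Bᵀw≈0 j))

    singular : Singular (columnOp A p t) → ¬ ¬ Singular A
    singular (detB≈0 , kernel , cokernel) =
      ¬¬-map (λ kerA → trans (sym (det-columnOp n A p t tp≈0)) detB≈0 , kerA , hasKernelᵀ cokernel) (hasKernel kernel)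

  module PivotRow {m} (B : Matrix (suc m)) (c : Fin (suc m))
                  (offPivot : ∀ s → s ≢ c → B zero s ≈ 0#) (pivot≉0 : ¬ B zero c ≈ 0#) where
    M : Matrix m
    M = minor B c

    det-pivotRow : det (suc m) B ≈ sgn (toℕ c) * B zero c * det m M
    det-pivotRow = sum-single m (expansionTerm B) c λ j j≢c →
      trans (*-congʳ (trans (*-congˡ (offPivot j j≢c)) (zeroʳ _))) (zeroˡ _)

    mulVec-first : ∀ u → mulVec B u zero ≈ B zero c * u c
    mulVec-first u = sum-single m (λ s → B zero s * u s) c λ s s≢c → trans (*-congʳ (offPivot s s≢c)) (zeroˡ _)

    mulVec-rest : ∀ u r → mulVec B u (suc r) ≈ B (suc r) c * u c + mulVec M (u ∘ punchIn c) r
    mulVec-rest u r = sum-remove m (λ s → B (suc r) s * u s) c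

    mulVecᵀ-punchIn : ∀ w k → mulVec (transpose B) w (punchIn c k) ≈ mulVec (transpose M) (w ∘ suc) k
    mulVecᵀ-punchIn w k =
      trans (+-congʳ (trans (*-congʳ (offPivot _ (punchInᵢ≢i c k))) (zeroˡ _))) (+-identityˡ _)

    nonsingular : Nonsingular M → Nonsingular B
    nonsingular detM≉0 detB≈0 =
      *-nonzero (*-nonzero (sgn≉0 (toℕ c)) pivot≉0) detM≉0 (trans (sym det-pivotRow) detB≈0)

    kernelTrivial : KernelTrivial M → KernelTrivial B
    kernelTrivial trivial u Bu≈0 = punchIn-cases c uc≈0 (trivial (u ∘ punchIn c) λ r → begin
      mulVec M (u ∘ punchIn c) r                     ≈⟨ +-identityˡ _ ⟨
      0# + mulVec M (u ∘ punchIn c) r                ≈⟨ +-congʳ (trans (*-congˡ uc≈0) (zeroʳ _)) ⟨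
      B (suc r) c * u c + mulVec M (u ∘ punchIn c) r ≈⟨ mulVec-rest u r ⟨
      mulVec B u (suc r)                             ≈⟨ Bu≈0 (suc r) ⟩
      0#                                             ∎)
      where
      uc≈0 : u c ≈ 0#
      uc≈0 = x*y≈0⇒y≈0 pivot≉0 (trans (sym (mulVec-first u)) (Bu≈0 zero))

    columnsSpan : ColumnsSpan M → ColumnsSpan B
    columnsSpan span y = x , solves
      where
      xc = B zero c ⁻¹⟨ pivot≉0 ⟩ * y zero
      y′ : Fin m → Carrier
      y′ r = y (suc r) + - (B (suc r) c * xc)
      x = insertAt (proj₁ (span y′)) c xc
      solves : ∀ i → mulVec B x i ≈ y i
      solves zero = trans (mulVec-first x)
        (trans (*-congˡ (reflexive (insertAt-lookup _ c xc))) (x*[x⁻¹*y]≈y _ pivot≉0 (y zero)))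
      solves (suc r) = begin
        mulVec B x (suc r)                                    ≈⟨ mulVec-rest x r ⟩
        B (suc r) c * x c + mulVec M (x ∘ punchIn c) r        ≈⟨ +-cong (*-congˡ (reflexive (insertAt-lookup _ c xc)))
                                                                   (trans (mulVec-cong M (reflexive ∘ insertAt-punchIn _ c xc) r)
                                                                          (proj₂ (span y′) r)) ⟩
        B (suc r) c * xc + (y (suc r) + - (B (suc r) c * xc)) ≈⟨ x+[y+z]≈y+[x+z] _ _ _ ⟩
        y (suc r) + (B (suc r) c * xc + - (B (suc r) c * xc)) ≈⟨ +-congˡ (-‿inverseʳ _) ⟩
        y (suc r) + 0#                                        ≈⟨ +-identityʳ _ ⟩
        y (suc r)                                             ∎

    hasKernel : HasKernel M → HasKernel B
    hasKernel (u′ , (k , u′k≉0) , Mu′≈0) = u , (punchIn c k , uk≉0) , Bu≈0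
      where
      u = insertAt u′ c 0#
      uk≉0 : ¬ u (punchIn c k) ≈ 0#
      uk≉0 = ≡.subst (λ x → ¬ x ≈ 0#) (≡.sym (insertAt-punchIn u′ c 0# k)) u′k≉0
      uc≈0 : u c ≈ 0#
      uc≈0 = reflexive (insertAt-lookup u′ c 0#)
      Bu≈0 : Kernel B u
      Bu≈0 zero    = trans (mulVec-first u) (trans (*-congˡ uc≈0) (zeroʳ _))
      Bu≈0 (suc r) = trans (mulVec-rest u r) (trans
        (+-cong (trans (*-congˡ uc≈0) (zeroʳ _))
                (trans (mulVec-cong M (reflexive ∘ insertAt-punchIn u′ c 0#) r) (Mu′≈0 r)))
        (+-identityʳ 0#))

    -- w₀ is chosen to cancel column c, which M does not see.
    hasKernelᵀ : HasKernel (transpose M) → HasKernel (transpose B)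
    hasKernelᵀ (w′ , (r₀ , w′r₀≉0) , Mᵀw′≈0) = w , (suc r₀ , w′r₀≉0) , Bᵀw≈0
      where
      S = sum m (λ r → B (suc r) c * w′ r)
      w : Fin (suc m) → Carrier
      w zero    = - (B zero c ⁻¹⟨ pivot≉0 ⟩ * S)
      w (suc r) = w′ r
      Bᵀw≈0 : Kernel (transpose B) w
      Bᵀw≈0 = punchIn-cases c (begin
        B zero c * - (B zero c ⁻¹⟨ pivot≉0 ⟩ * S) + S   ≈⟨ +-congʳ (sym (-‿distribʳ-* _ _)) ⟩
        - (B zero c * (B zero c ⁻¹⟨ pivot≉0 ⟩ * S)) + S ≈⟨ +-congʳ (-‿cong (x*[x⁻¹*y]≈y _ pivot≉0 S)) ⟩
        - S + S                                         ≈⟨ -‿inverseˡ S ⟩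
        0#                                              ∎) λ k → trans (mulVecᵀ-punchIn w k) (Mᵀw′≈0 k)

    regular : Regular M → Regular B
    regular (detM≉0 , trivial , span) = nonsingular detM≉0 , kernelTrivial trivial , columnsSpan span

    singular : Singular M → Singular B
    singular (detM≈0 , kernel , cokernel) =
      trans det-pivotRow (trans (*-congˡ detM≈0) (zeroʳ _)) , hasKernel kernel , hasKernelᵀ cokernel

  zeroRow-singular : ∀ m (A : Matrix (suc m)) → (∀ s → A zero s ≈ 0#) →
                     Regular (minor A zero) ⊎ Singular (minor A zero) → Singular A
  zeroRow-singular m A zeroRow minorCases = det≈0 , kernel minorCases , cokernel
    where
    det≈0 : det (suc m) A ≈ 0#
    det≈0 = sum-zero (suc m) {expansionTerm A} λ j →
      trans (*-congʳ (trans (*-congˡ {sgn (toℕ j)} (zeroRow j)) (zeroʳ _))) (zeroˡ _)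
    first : ∀ v → mulVec A v zero ≈ 0#
    first v = sum-zero (suc m) {λ s → A zero s * v s} λ s → trans (*-congʳ (zeroRow s)) (zeroˡ _)
    cokernel : HasKernel (transpose A)
    cokernel = unit zero , (zero , 1≉0) , λ j → trans (sum-*-unit (suc m) (λ i → A i j) zero) (zeroRow j)
    kernel : Regular (minor A zero) ⊎ Singular (minor A zero) → HasKernel A
    kernel (inj₁ (_ , _ , span)) = v , (zero , 1≉0) , Av≈0
      where
      x′ = proj₁ (span λ r → - A (suc r) zero)
      v : Fin (suc m) → Carrier
      v zero    = 1#
      v (suc s) = x′ s
      Av≈0 : Kernel A v
      Av≈0 zero    = first v
      Av≈0 (suc r) = trans (+-cong (*-identityʳ _) (proj₂ (span λ r → - A (suc r) zero) r)) (-‿inverseʳ _)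
    kernel (inj₂ (_ , (u′ , (k , u′k≉0) , Mu′≈0) , _)) = v , (suc k , u′k≉0) , Av≈0
      where
      v : Fin (suc m) → Carrier
      v zero    = 0#
      v (suc s) = u′ s
      Av≈0 : Kernel A v
      Av≈0 zero    = first v
      Av≈0 (suc r) = trans (+-cong (zeroʳ _) (Mu′≈0 r)) (+-identityʳ 0#)

  module Pivot {m} (A : Matrix (suc m)) (c : Fin (suc m)) (pivot≉0 : ¬ A zero c ≈ 0#) where
    t : Fin (suc m) → Carrier
    t = insertAt (λ k → - (A zero (punchIn c k) * A zero c ⁻¹⟨ pivot≉0 ⟩)) c 0#

    tc≈0 : t c ≈ 0#
    tc≈0 = reflexive (insertAt-lookup _ c 0#)

    B : Matrix (suc m)
    B = columnOp A c t

    B-offPivot : ∀ s → s ≢ c → B zero s ≈ 0#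
    B-offPivot s s≢c = ≡.subst (λ s → B zero s ≈ 0#) (punchIn-punchOut (s≢c ∘ ≡.sym)) (cleared _)
      where
      cleared : ∀ k → B zero (punchIn c k) ≈ 0#
      cleared k = begin
        a + t (punchIn c k) * p          ≈⟨ +-congˡ (*-congʳ (reflexive (insertAt-punchIn _ c 0# k))) ⟩
        a + - (a * p ⁻¹⟨ pivot≉0 ⟩) * p  ≈⟨ +-congˡ (sym (-‿distribˡ-* _ p)) ⟩
        a + - (a * p ⁻¹⟨ pivot≉0 ⟩ * p)  ≈⟨ +-congˡ (-‿cong (trans (*-assoc a _ p) (*-congˡ (x⁻¹*x≈1 p pivot≉0)))) ⟩
        a + - (a * 1#)                   ≈⟨ +-congˡ (-‿cong (*-identityʳ a)) ⟩
        a + - a                          ≈⟨ -‿inverseʳ a ⟩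
        0#                               ∎
        where
        a = A zero (punchIn c k)
        p = A zero c

    B-pivot≉0 : ¬ B zero c ≈ 0#
    B-pivot≉0 Bc≈0 = pivot≉0 (trans (sym (columnOp-unchanged A c {t} zero tc≈0)) Bc≈0)

  -- Equality in K need not be decidable, so whether the first row vanishes is only known ¬¬.
  regular-or-singular : ∀ n (A : Matrix n) → ¬ ¬ (Regular A ⊎ Singular A)
  regular-or-singular zero    A k = k (inj₁ (1≉0 , (λ _ _ ()) , λ _ → (λ ()) , λ ()))
  regular-or-singular (suc m) A = ¬¬-bind (¬¬-all-or-counterexample (suc m) λ s → A zero s ≈ 0#) λ where
    (inj₁ zeroRow) → ¬¬-map (inj₂ ∘ zeroRow-singular m A zeroRow) (regular-or-singular m (minor A zero))
    (inj₂ (c , pivot≉0)) →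
      let open Pivot A c pivot≉0
          module Row = PivotRow B c B-offPivot B-pivot≉0
          module Col = ColumnOperation A c t tc≈0
      in ¬¬-bind (regular-or-singular m Row.M) λ where
           (inj₁ regular)  k → k (inj₁ (Col.regular (Row.regular regular)))
           (inj₂ singular)   → ¬¬-map inj₂ (Col.singular (Row.singular singular))

  columnsSpan⇒¬hasKernelᵀ : ∀ {n} (A : Matrix n) → ColumnsSpan A → ¬ HasKernel (transpose A)
  columnsSpan⇒¬hasKernelᵀ {n} A span (w , (k , wk≉0) , Aᵀw≈0) = wk≉0 (begin
    w k                                          ≈⟨ sum-*-unit n w k ⟨
    sum n (λ i → w i * unit k i)                 ≈⟨ sum-cong n (λ i → *-congˡ (proj₂ (span (unit k)) i)) ⟨
    sum n (λ i → w i * mulVec A x i)             ≈⟨ sum-cong n (λ i → *-distribˡ-sum n (w i) _) ⟩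
    sum n (λ i → sum n (λ j → w i * (A i j * x j))) ≈⟨ sum-comm n n _ ⟩
    sum n (λ j → sum n (λ i → w i * (A i j * x j))) ≈⟨ sum-cong n (λ j → sum-cong n λ i → rearrange (w i) (A i j) (x j)) ⟩
    sum n (λ j → sum n (λ i → x j * (A i j * w i))) ≈⟨ sum-cong n (λ j → sym (*-distribˡ-sum n (x j) _)) ⟩
    sum n (λ j → x j * mulVec (transpose A) w j) ≈⟨ sum-zero n (λ j → trans (*-congˡ (Aᵀw≈0 j)) (zeroʳ _)) ⟩
    0# ∎)
    where
    x = proj₁ (span (unit k))
    rearrange : ∀ a b d → a * (b * d) ≈ d * (b * a)
    rearrange = x∙yz≈z∙yx
      where open CommutativeSemigroupProperties *-commutativeSemigroup using (x∙yz≈z∙yx)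

  nonsingular⇒¬hasKernel : ∀ {n} (A : Matrix n) → Nonsingular A → ¬ HasKernel A
  nonsingular⇒¬hasKernel {n} A nonsingular (v , (j , vj≉0) , Av≈0) = regular-or-singular n A λ where
    (inj₁ (_ , trivial , _)) → vj≉0 (trivial v Av≈0 j)
    (inj₂ (det≈0 , _))       → nonsingular det≈0

  nonsingular⇒¬hasKernelᵀ : ∀ {n} (A : Matrix n) → Nonsingular A → ¬ HasKernel (transpose A)
  nonsingular⇒¬hasKernelᵀ {n} A nonsingular cokernel = regular-or-singular n A λ where
    (inj₁ (_ , _ , span)) → columnsSpan⇒¬hasKernelᵀ A span cokernel
    (inj₂ (det≈0 , _))    → nonsingular det≈0

  singular⇒¬¬hasKernel : ∀ {n} (A : Matrix n) → det n A ≈ 0# → ¬ ¬ HasKernel A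
  singular⇒¬¬hasKernel {n} A det≈0 ¬kernel = regular-or-singular n A λ where
    (inj₁ (nonsingular , _)) → nonsingular det≈0
    (inj₂ (_ , kernel , _))  → ¬kernel kernel

  singular⇒¬¬hasKernelᵀ : ∀ {n} (A : Matrix n) → det n A ≈ 0# → ¬ ¬ HasKernel (transpose A)
  singular⇒¬¬hasKernelᵀ {n} A det≈0 ¬cokernel = regular-or-singular n A λ where
    (inj₁ (nonsingular , _)) → nonsingular det≈0
    (inj₂ (_ , _ , cokernel)) → ¬cokernel cokernel

module Lifts {c ℓ h} (K : CommutativeRing c ℓ) (isField : IsField K)
             (H : Pred (CommutativeRing.Carrier K) h) where
  open CommutativeRing K hiding (zero) renaming (refl to ≈-refl)
  open QuotientHyperfield K H
  open Summation K H
  open Determinant K H using (Matrix)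
  open Elimination K isField H

  IsLift : ∀ {m n} → (Fin m → Fin n → Carrier) → (Fin m → Fin n → Carrier) → Set (c ⊔ ℓ ⊔ h)
  IsLift A′ A = ∀ i j → A′ i j ∼ A i j

  columnsDependent⇒liftWithKernel : ∀ {m n} (A : Fin m → Fin n → Carrier) → ColumnsDependent A →
                                    Σ (Fin m → Fin n → Carrier) λ A′ → IsLift A′ A × HasKernel A′
  columnsDependent⇒liftWithKernel {n = n} A (a , nonzero , null) =
    A′ , (λ i j → g i j , proj₁ (proj₂ (null i)) j , ≈-refl) , a , nonzero , kernel
    where
    g : ∀ i j → Carrier
    g i = proj₁ (null i)
    A′ = λ i j → g i j * A i j
    kernel : Kernel A′ a
    kernel i = trans (sum-cong n λ j → trans (*-assoc (g i j) _ _) (*-congˡ (*-comm _ (a j))))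
                     (proj₂ (proj₂ (null i)))

  liftWithKernel⇒columnsDependent : ∀ {m n} {A A′ : Fin m → Fin n → Carrier} →
                                    IsLift A′ A → HasKernel A′ → ColumnsDependent A
  liftWithKernel⇒columnsDependent {n = n} {A} {A′} isLift (v , nonzero , kernel) = v , nonzero , λ i →
    (λ j → proj₁ (isLift i j)) , (λ j → proj₁ (proj₂ (isLift i j))) ,
    trans (sum-cong n λ j → trans (*-congˡ (*-comm (v j) _))
                                  (trans (sym (*-assoc _ _ (v j))) (*-congʳ (sym (proj₂ (proj₂ (isLift i j)))))))
          (kernel i)

  allLiftsNonsingular⇔columnsIndependent : ∀ {n} (A : Matrix n) →
                                          AllLiftsNonsingular A ⇔ ColumnsIndependent A
  allLiftsNonsingular⇔columnsIndependent A = mk⇔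
    (λ nonsingular dependent →
       let A′ , isLift , kernel = columnsDependent⇒liftWithKernel A dependent
       in nonsingular⇒¬hasKernel A′ (nonsingular A′ isLift) kernel)
    (λ independent A′ isLift det≈0 → singular⇒¬¬hasKernel A′ det≈0 λ kernel →
       independent (liftWithKernel⇒columnsDependent isLift kernel))

  -- Lifts of transpose A are exactly the transposes of lifts of A.
  allLiftsNonsingular⇔columnsIndependentᵀ : ∀ {n} (A : Matrix n) →
                                           AllLiftsNonsingular A ⇔ ColumnsIndependent (transpose A)
  allLiftsNonsingular⇔columnsIndependentᵀ A = mk⇔
    (λ nonsingular dependent →
       let B , isLift , kernel = columnsDependent⇒liftWithKernel (transpose A) dependent
       in nonsingular⇒¬hasKernelᵀ (transpose B) (nonsingular (transpose B) λ i j → isLift j i) kernel)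
    (λ independent A′ isLift det≈0 → singular⇒¬¬hasKernelᵀ A′ det≈0 λ cokernel →
       independent (liftWithKernel⇒columnsDependent (λ i j → isLift j i) cokernel))

module MatroidCircuits {L n r} (M : Matroid {L} n r) where
  open Matroid M

  empty-independent : ∀ S → (∀ x → x ∉ S) → Independent S
  empty-independent S empty = proj₁ nonempty , proj₂ nonempty , λ {x} x∈S → ⊥-elim (empty x x∈S)

  circuit-nonempty : ∀ {C} → IsCircuit C → Nonempty C
  circuit-nonempty {C} (dependent , _) with nonempty? C
  ... | yes nonemptyC = nonemptyC
  ... | no  emptyC    = ⊥-elim (dependent (empty-independent C λ x x∈C → emptyC (x , x∈C)))

  -- Removing elements while the set stays dependent ends at a circuit.
  ¬¬-circuit-inside : ∀ k S → ∣ S ∣ ℕ.≤ k → ¬ Independent S → ¬ ¬ (∃[ C ] IsCircuit C)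
  ¬¬-circuit-inside zero S ∣S∣≤0 dependent = ⊥-elim (dependent (empty-independent S λ x x∈S →
    ℕₚ.n≮0 (ℕₚ.<-≤-trans (x∈p⇒∣p-x∣<∣p∣ x∈S) ∣S∣≤0)))
  ¬¬-circuit-inside (suc k) S ∣S∣≤1+k dependent =
    ¬¬-bind (¬¬-all-or-counterexample n λ e → e ∈ S → Independent (S - e)) λ where
      (inj₁ minimal) found → found (S , dependent , minimal)
      (inj₂ (e , ¬removable)) → shrink e ¬removable (e ∈? S)
    where
    shrink : ∀ e → ¬ (e ∈ S → Independent (S - e)) → Dec (e ∈ S) → ¬ ¬ (∃[ C ] IsCircuit C)
    shrink e ¬removable (yes e∈S) = ¬¬-circuit-inside k (S - e)
      (ℕₚ.≤-pred (ℕₚ.<-≤-trans (x∈p⇒∣p-x∣<∣p∣ e∈S) ∣S∣≤1+k)) λ independent → ¬removable λ _ → independent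
    shrink e ¬removable (no e∉S) = ⊥-elim (¬removable λ e∈S → ⊥-elim (e∉S e∈S))

  ¬¬-circuit : r ℕ.< n → ¬ ¬ (∃[ C ] IsCircuit C)
  ¬¬-circuit r<n = ¬¬-circuit-inside n ⊤ (ℕₚ.≤-reflexive (∣⊤∣≡n n)) λ (B , isBasis , ⊤⊆B) →
    ℕₚ.<⇒≱ r<n (≡.subst (n ℕ.≤_) (rank B isBasis) (≡.subst (ℕ._≤ ∣ B ∣) (∣⊤∣≡n n) (p⊆q⇒∣p∣≤∣q∣ ⊤⊆B)))

module QuotientArithmetic {c ℓ h} (K : CommutativeRing c ℓ) (isField : IsField K)
                          (H : Pred (CommutativeRing.Carrier K) h) (isH : IsUnitSubgroup K H) where
  open CommutativeRing K hiding (zero) renaming (refl to ≈-refl)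
  open RingProperties ring using (-‿distribʳ-*; -‿involutive; +-inverseʳ-unique; +-inverseˡ-unique)
  open CommutativeSemigroupProperties *-commutativeSemigroup using (x∙yz≈y∙xz)
  open QuotientHyperfield K H
  open Summation K H
  open FieldProperties K isField
  open Elimination K isField H using (unit; unit-≡; unit-≢)
  open import Relation.Binary.Reasoning.Setoid setoid
  private module U = IsUnitSubgroup isH

  ∼-reflexive : ∀ {x y} → x ≈ y → x ∼ y
  ∼-reflexive {y = y} x≈y = 1# , U.one , trans x≈y (sym (*-identityˡ y))

  cancel-unit : ∀ {g g′ y z} → g * g′ ≈ 1# → g * y ≈ z → y ≈ g′ * z
  cancel-unit {g} {g′} {y} {z} gg′≈1 gy≈z = begin
    y              ≈⟨ *-identityˡ y ⟨
    1# * y         ≈⟨ *-congʳ (trans (*-comm g′ g) gg′≈1) ⟨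
    g′ * g * y     ≈⟨ *-assoc g′ g y ⟩
    g′ * (g * y)   ≈⟨ *-congˡ gy≈z ⟩
    g′ * z         ∎

  ∼-sym : ∀ {x y} → x ∼ y → y ∼ x
  ∼-sym (g , Hg , x≈gy) with U.inv Hg
  ... | g′ , Hg′ , gg′≈1 = g′ , Hg′ , cancel-unit gg′≈1 (sym x≈gy)

  ∼-trans : ∀ {x y z} → x ∼ y → y ∼ z → x ∼ z
  ∼-trans (g , Hg , x≈gy) (g′ , Hg′ , y≈g′z) =
    g * g′ , U.mul Hg Hg′ , trans x≈gy (trans (*-congˡ y≈g′z) (sym (*-assoc g g′ _)))

  ∼-*ˡ : ∀ k {x y} → x ∼ y → (k * x) ∼ (k * y)
  ∼-*ˡ k (g , Hg , x≈gy) = g , Hg , trans (*-congˡ x≈gy) (x∙yz≈y∙xz k g _)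

  ∼-cancelˡ : ∀ {k x y} → ¬ k ≈ 0# → (k * x) ∼ (k * y) → x ∼ y
  ∼-cancelˡ {k} k≉0 (g , Hg , kx≈gky) = g , Hg , *-cancelˡ k≉0 (trans kx≈gky (x∙yz≈y∙xz g k _))

  ∼-zero : ∀ {x y} → x ∼ y → y ≈ 0# → x ≈ 0#
  ∼-zero (g , _ , x≈gy) y≈0 = trans x≈gy (trans (*-congˡ y≈0) (zeroʳ g))

  sum≈0⇒null : ∀ n {x : Fin n → Carrier} → sum n x ≈ 0# → Null n x
  sum≈0⇒null n {x} sum≈0 = (λ _ → 1#) , (λ _ → U.one) , trans (sum-cong n λ i → *-identityˡ (x i)) sum≈0

  null-resp : ∀ n {x y : Fin n → Carrier} → Null n x → (∀ i → x i ∼ y i) → Null n y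
  null-resp n {x} {y} (g , Hg , null) x∼y =
    (λ i → g i * proj₁ (x∼y i)) , (λ i → U.mul (Hg i) (proj₁ (proj₂ (x∼y i)))) ,
    trans (sum-cong n λ i → trans (*-assoc (g i) _ (y i)) (*-congˡ (sym (proj₂ (proj₂ (x∼y i)))))) null

  null-scale : ∀ n {x : Fin n → Carrier} → Null n x → ∀ k → Null n (λ i → k * x i)
  null-scale n {x} (g , Hg , null) k = g , Hg ,
    trans (sum-cong n λ i → x∙yz≈y∙xz (g i) k (x i))
          (trans (sym (*-distribˡ-sum n k (λ i → g i * x i))) (trans (*-congˡ null) (zeroʳ k)))

  null-proportional : ∀ n (a Z X : Fin n → Carrier) k → Null n (λ i → a i * Z i) →
                      (∀ i → X i ∼ (k * a i)) → Null n (λ i → X i * Z i)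
  null-proportional n a Z X k null X∼ka = null-resp n (null-scale n null k) λ i →
    ∼-trans (∼-reflexive (sym (*-assoc k (a i) (Z i)))) (∼-sym (∼-*ʳ (Z i) (X∼ka i)))
    where
    ∼-*ʳ : ∀ z {x y} → x ∼ y → (x * z) ∼ (y * z)
    ∼-*ʳ z {y = y} (g , Hg , x≈gy) = g , Hg , trans (*-congʳ x≈gy) (*-assoc g y z)

  NullPair : Carrier → Carrier → Set (ℓ ⊔ h ⊔ c)
  NullPair x y = Σ Carrier λ g → Σ Carrier λ g′ → H g × H g′ × (g * x + g′ * y ≈ 0#)

  null⇒nullPair : ∀ n (x : Fin (suc n) → Carrier) {i j} → i ≢ j → (∀ k → k ≢ i → k ≢ j → x k ≈ 0#) →
                  Null (suc n) x → NullPair (x i) (x j)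
  null⇒nullPair n x {i} {j} i≢j off (g , Hg , null) = g i , g j , Hg i , Hg j ,
    trans (sym (sum-pair n (λ k → g k * x k) i≢j λ k k≢i k≢j → trans (*-congˡ (off k k≢i k≢j)) (zeroʳ _))) null

  nullPair-unique : ∀ {x y x′ y′} → NullPair x y → NullPair x′ y′ → x ∼ x′ → y ∼ y′
  nullPair-unique {x} {y} {x′} {y′} (g₁ , g₂ , Hg₁ , Hg₂ , null) (g₁′ , g₂′ , Hg₁′ , Hg₂′ , null′) (h , Hh , x≈hx′)
    with U.inv Hg₂ | U.inv Hg₁′
  ... | u₂ , Hu₂ , g₂u₂≈1 | u₁′ , Hu₁′ , g₁′u₁′≈1 =
    u₂ * (g₁ * (h * (u₁′ * g₂′))) , U.mul Hu₂ (U.mul Hg₁ (U.mul Hh (U.mul Hu₁′ Hg₂′))) , (begin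
      y                                                   ≈⟨ cancel-unit g₂u₂≈1 (+-inverseʳ-unique _ _ null) ⟩
      u₂ * - (g₁ * x)                                     ≈⟨ *-congˡ (-‿cong (*-congˡ (trans x≈hx′ (*-congˡ x′≈)))) ⟩
      u₂ * - (g₁ * (h * (u₁′ * - (g₂′ * y′))))             ≈⟨ *-congˡ (-‿cong (*-congˡ (*-congˡ (-‿distribʳ-* _ _)))) ⟨
      u₂ * - (g₁ * (h * - (u₁′ * (g₂′ * y′))))             ≈⟨ *-congˡ (-‿cong (*-congˡ (-‿distribʳ-* _ _))) ⟨
      u₂ * - (g₁ * - (h * (u₁′ * (g₂′ * y′))))             ≈⟨ *-congˡ (-‿cong (-‿distribʳ-* _ _)) ⟨
      u₂ * - - (g₁ * (h * (u₁′ * (g₂′ * y′))))             ≈⟨ *-congˡ (-‿involutive _) ⟩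
      u₂ * (g₁ * (h * (u₁′ * (g₂′ * y′))))                 ≈⟨ reassociate u₂ g₁ h u₁′ g₂′ y′ ⟩
      u₂ * (g₁ * (h * (u₁′ * g₂′))) * y′                   ∎)
    where
    x′≈ : x′ ≈ u₁′ * - (g₂′ * y′)
    x′≈ = cancel-unit g₁′u₁′≈1 (+-inverseˡ-unique _ _ null′)
    reassociate : ∀ a b d e f z → a * (b * (d * (e * (f * z)))) ≈ a * (b * (d * (e * f))) * z
    reassociate = solve 6 (λ a b d e f z → a ⊕ (b ⊕ (d ⊕ (e ⊕ (f ⊕ z)))) ⊜ (a ⊕ (b ⊕ (d ⊕ (e ⊕ f)))) ⊕ z) ≈-refl
      where open import Algebra.Solver.CommutativeMonoid *-commutativeMonoid using (solve; _⊜_; _⊕_)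

  ∈-support : ∀ {n} {X : FVec n} {S} → Support X S → ∀ {i} → ¬ X i ≈ 0# → i ∈ S
  ∈-support {S = S} supp {i} Xi≉0 with i ∈? S
  ... | yes i∈S = i∈S
  ... | no  i∉S = ⊥-elim (Xi≉0 (proj₂ (supp i) i∉S))

  support-unique : ∀ {n} {X : FVec n} {S T} → Support X S → Support X T → S ≡ T
  support-unique suppS suppT = ⊆-antisym (inside suppS suppT) (inside suppT suppS)
    where
    inside : ∀ {S T} → Support _ S → Support _ T → S ⊆ T
    inside suppS suppT {i} i∈S = ∈-support suppT (proj₁ (suppS i) i∈S)

  support-resp : ∀ {n} {X Y : FVec n} {S} → Support X S → X ≋ Y → Support Y S
  support-resp supp X∼Y i = (λ i∈S Yi≈0 → proj₁ (supp i) i∈S (∼-zero (X∼Y i) Yi≈0)) ,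
                            (λ i∉S → ∼-zero (∼-sym (X∼Y i)) (proj₂ (supp i) i∉S))

  support-scale : ∀ {n} {X : FVec n} {S} k → ¬ k ≈ 0# → Support X S → Support (λ i → k * X i) S
  support-scale k k≉0 supp i = (λ i∈S → *-nonzero k≉0 (proj₁ (supp i) i∈S)) ,
                               (λ i∉S → trans (*-congˡ (proj₂ (supp i) i∉S)) (zeroʳ k))

  support-unit : ∀ {n} {S : Subset n} {e} → e ∈ S → (∀ x → x ∈ S → x ≡ e) → Support (unit e) S
  support-unit {e = e} e∈S only-e i with i ≟ e
  ... | yes refl = (λ _ → 1≉0 ∘ trans (reflexive (≡.sym (unit-≡ i)))) , (λ i∉S → ⊥-elim (i∉S e∈S))
  ... | no  i≢e  = (λ i∈S → ⊥-elim (i≢e (only-e i i∈S))) , (λ _ → reflexive (unit-≢ i≢e))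

  proportional-on-singleton : ∀ {n} {X Y : FVec n} {S e} → Support X S → Support Y S →
    e ∈ S → (∀ x → x ∈ S → x ≡ e) → ∃[ b ] (¬ b ≈ 0# × Y ≋ (λ i → b * X i))
  proportional-on-singleton {X = X} {Y} {e = e} suppX suppY e∈S only-e =
    b , *-nonzero Ye≉0 (⁻¹-nonzero (X e) Xe≉0) , proportional
    where
    Xe≉0 = proj₁ (suppX e) e∈S
    Ye≉0 = proj₁ (suppY e) e∈S
    b = Y e * X e ⁻¹⟨ Xe≉0 ⟩
    proportional : ∀ i → Y i ∼ (b * X i)
    proportional i with i ≟ e
    ... | yes refl = ∼-reflexive (sym (trans (*-assoc _ _ (X i)) (trans (*-congˡ (x⁻¹*x≈1 (X i) Xe≉0)) (*-identityʳ _))))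
    ... | no  i≢e  = ∼-reflexive (trans (proj₂ (suppY i) i∉S) (sym (trans (*-congˡ (proj₂ (suppX i) i∉S)) (zeroʳ b))))
      where i∉S = λ i∈S → i≢e (only-e i i∈S)

module FreeFMatroid {c ℓ h} (K : CommutativeRing c ℓ) (isField : IsField K)
                    (H : Pred (CommutativeRing.Carrier K) h) (isH : IsUnitSubgroup K H) (n : ℕ) where
  open CommutativeRing K hiding (zero) renaming (refl to ≈-refl)
  open QuotientHyperfield K H
  open FieldProperties K isField
  open Elimination K isField H using (unit; unit-≡; unit-≢)
  open QuotientArithmetic K isField H isH

  freeMatroid : Matroid {L} n n
  freeMatroid = record
    { IsBasis  = λ B → Lift L (B ≡ ⊤)
    ; nonempty = ⊤ , lift refl
    ; exchange = λ { _ _ _ (lift refl) _ _ x∉⊤ → ⊥-elim (x∉⊤ ∈⊤) }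
    ; rank     = λ { _ (lift refl) → ∣⊤∣≡n n }
    }
  open Matroid freeMatroid

  HasSingleEntry : FVec n → Set ℓ
  HasSingleEntry X = ∃[ e ] (¬ X e ≈ 0# × ∀ i → i ≢ e → X i ≈ 0#)

  cocircuit-singleton : ∀ {S} → IsCocircuit S → ∃[ e ] (e ∈ S × ∀ x → x ∈ S → x ≡ e)
  cocircuit-singleton {S} (meets , minimal) with meets ⊤ (lift refl)
  ... | e , e∈S , _ with minimal e e∈S
  ...   | _ , lift refl , avoids = e , e∈S , only-e
    where
    only-e : ∀ x → x ∈ S → x ≡ e
    only-e x x∈S with x ≟ e
    ... | yes x≡e = x≡e
    ... | no  x≢e = ⊥-elim (avoids x (x∈p∧x≢y⇒x∈p-y x∈S x≢e) ∈⊤)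

  singleEntry-cocircuit : ∀ {X S} → HasSingleEntry X → Support X S → IsCocircuit S
  singleEntry-cocircuit {X} {S} (e , Xe≉0 , off) supp =
    (λ { _ (lift refl) → e , ∈-support supp Xe≉0 , ∈⊤ }) ,
    λ e′ e′∈S → ⊤ , lift refl , λ x x∈S-e′ _ →
      x∈p-y⇒x≢y x∈S-e′ (≡.trans (only-e x (p─q⊆p S _ x∈S-e′)) (≡.sym (only-e e′ e′∈S)))
    where
    only-e : ∀ x → x ∈ S → x ≡ e
    only-e x x∈S with x ≟ e
    ... | yes x≡e = x≡e
    ... | no  x≢e = ⊥-elim (proj₁ (supp x) x∈S (off x x≢e))

  freeFMatroid : FMatroid n n
  freeFMatroid = record
    { underlying    = freeMatroid
    ; Circ          = λ _ → Lift L ⊥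
    ; Cocirc        = λ X → Lift L (HasSingleEntry X)
    ; Circ-resp     = λ ()
    ; Cocirc-resp   = λ { (lift (e , Xe≉0 , off)) X≋Y →
                          lift (e , Xe≉0 ∘ ∼-zero (X≋Y e) , λ i i≢e → ∼-zero (∼-sym (X≋Y i)) (off i i≢e)) }
    ; Circ-scale    = λ _ _ ()
    ; Cocirc-scale  = λ { a a≉0 (lift (e , Xe≉0 , off)) →
                          lift (e , *-nonzero a≉0 Xe≉0 , λ i i≢e → trans (*-congˡ (off i i≢e)) (zeroʳ a)) }
    ; Circ-supp     = λ ()
    ; Cocirc-supp   = singleEntry-cocircuit ∘ lower
    ; Circ-exists   = λ S (dependent , _) → ⊥-elim (dependent (⊤ , lift refl , λ _ → ∈⊤))
    ; Cocirc-exists = λ S cocircuit →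
        let e , e∈S , only-e = cocircuit-singleton cocircuit
        in unit e , lift (e , 1≉0 ∘ trans (reflexive (≡.sym (unit-≡ e))) , λ i i≢e → reflexive (unit-≢ i≢e)) ,
           support-unit e∈S only-e
    ; Circ-unique   = λ ()
    ; Cocirc-unique = λ { cX _ suppX suppY →
        let e , e∈S , only-e = cocircuit-singleton (singleEntry-cocircuit (lower cX) suppX)
        in proportional-on-singleton suppX suppY e∈S only-e }
    ; orth          = λ ()
    }

module DependencyFMatroid {c ℓ h} (K : CommutativeRing c ℓ) (isField : IsField K)
  (H : Pred (CommutativeRing.Carrier K) h) (isH : IsUnitSubgroup K H)
  {m : ℕ} (a : Fin (suc m) → CommutativeRing.Carrier K)
  (a? : ∀ i → Dec (CommutativeRing._≈_ K (a i) (CommutativeRing.0# K)))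
  (j₀ : Fin (suc m)) (aj₀≉0 : ¬ CommutativeRing._≈_ K (a j₀) (CommutativeRing.0# K)) where
  open CommutativeRing K hiding (zero; _-_) renaming (refl to ≈-refl)
  open RingProperties ring using (-‿distribʳ-*)
  open CommutativeSemigroupProperties *-commutativeSemigroup using (x∙yz≈y∙xz)
  open QuotientHyperfield K H
  open Summation K H
  open FieldProperties K isField
  open Elimination K isField H using (unit; unit-≢)
  open QuotientArithmetic K isField H isH

  IsBasisAt : Fin (suc m) → Subset (suc m) → Set ℓ
  IsBasisAt e B = ¬ a e ≈ 0# × B ≡ ∁ ⁅ e ⁆

  exchange : ∀ {e₁ e₂} x → x ∈ ∁ ⁅ e₁ ⁆ → x ∉ ∁ ⁅ e₂ ⁆ → ¬ a e₂ ≈ 0# →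
             e₁ ∈ ∁ ⁅ e₂ ⁆ × e₁ ∉ ∁ ⁅ e₁ ⁆ × IsBasisAt e₂ ((∁ ⁅ e₁ ⁆ - x) ∪ ⁅ e₁ ⁆)
  exchange {e₁} {e₂} x x∈∁e₁ x∉∁e₂ ae₂≉0 =
    x≢y⇒x∈∁⁅y⁆ e₁≢e₂ , x∉∁⁅x⁆ e₁ , ae₂≉0 , ⊆-antisym forward backward
    where
    x≡e₂ = x∉∁⁅y⁆⇒x≡y x∉∁e₂
    e₁≢e₂ : e₁ ≢ e₂
    e₁≢e₂ e₁≡e₂ = x∈∁⁅y⁆⇒x≢y x∈∁e₁ (≡.trans x≡e₂ (≡.sym e₁≡e₂))
    forward : (∁ ⁅ e₁ ⁆ - x) ∪ ⁅ e₁ ⁆ ⊆ ∁ ⁅ e₂ ⁆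
    forward {z} z∈ with x∈p∪q⁻ (∁ ⁅ e₁ ⁆ - x) ⁅ e₁ ⁆ z∈
    ... | inj₁ z∈∁e₁-x = x≢y⇒x∈∁⁅y⁆ λ z≡e₂ → x∈p-y⇒x≢y z∈∁e₁-x (≡.trans z≡e₂ (≡.sym x≡e₂))
    ... | inj₂ z∈⁅e₁⁆  = x≢y⇒x∈∁⁅y⁆ λ z≡e₂ → e₁≢e₂ (≡.trans (≡.sym (x∈⁅y⁆⇒x≡y e₁ z∈⁅e₁⁆)) z≡e₂)
    backward : ∁ ⁅ e₂ ⁆ ⊆ (∁ ⁅ e₁ ⁆ - x) ∪ ⁅ e₁ ⁆
    backward {z} z∈∁e₂ with z ≟ e₁
    ... | yes refl = x∈p∪q⁺ (inj₂ (x∈⁅x⁆ z))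
    ... | no  z≢e₁ = x∈p∪q⁺ (inj₁ (x∈p∧x≢y⇒x∈p-y (x≢y⇒x∈∁⁅y⁆ z≢e₁)
                                    λ z≡x → x∈∁⁅y⁆⇒x≢y z∈∁e₂ (≡.trans z≡x x≡e₂)))

  dependencyMatroid : Matroid {L} (suc m) m
  dependencyMatroid = record
    { IsBasis  = λ B → Lift L (∃[ e ] IsBasisAt e B)
    ; nonempty = ∁ ⁅ j₀ ⁆ , lift (j₀ , aj₀≉0 , refl)
    ; exchange = λ { _ _ (lift (e₁ , _ , refl)) (lift (e₂ , ae₂≉0 , refl)) x x∈B₁ x∉B₂ →
                     let e₁∈B₂ , e₁∉B₁ , basis = exchange x x∈B₁ x∉B₂ ae₂≉0
                     in e₁ , e₁∈B₂ , e₁∉B₁ , lift (e₂ , basis) }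
    ; rank     = λ { _ (lift (e , _ , refl)) → ≡.trans (∣∁p∣≡n∸∣p∣ ⁅ e ⁆) (≡.cong (suc m ℕ.∸_) (∣⁅x⁆∣≡1 e)) }
    }
  open Matroid dependencyMatroid

  basisAt : ∀ {e} → ¬ a e ≈ 0# → IsBasis (∁ ⁅ e ⁆)
  basisAt {e} ae≉0 = lift (e , ae≉0 , refl)

  independent-avoiding : ∀ {I e} → ¬ a e ≈ 0# → e ∉ I → Independent I
  independent-avoiding {I} ae≉0 e∉I =
    _ , basisAt ae≉0 , λ {x} x∈I → x≢y⇒x∈∁⁅y⁆ λ { refl → e∉I x∈I }

  independent⇒avoids : ∀ {I} → Independent I → ∃[ e ] (¬ a e ≈ 0# × e ∉ I)
  independent⇒avoids (_ , lift (e , ae≉0 , refl) , I⊆B) = e , ae≉0 , λ e∈I → x∉∁⁅x⁆ e (I⊆B e∈I)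

  inside-circuit : ∀ {S e} → ¬ Independent S → ¬ a e ≈ 0# → e ∈ S
  inside-circuit {S} {e} dependent ae≉0 with e ∈? S
  ... | yes e∈S = e∈S
  ... | no  e∉S = ⊥-elim (dependent (independent-avoiding ae≉0 e∉S))

  circuit⇒support : ∀ {S} → IsCircuit S → Support a S
  circuit⇒support {S} (dependent , minimal) i = nonzero , zero-outside
    where
    nonzero : i ∈ S → ¬ a i ≈ 0#
    nonzero i∈S with independent⇒avoids (minimal i i∈S)
    ... | e , ae≉0 , e∉S-i with e ≟ i
    ...   | yes refl = ae≉0
    ...   | no  e≢i  = ⊥-elim (e∉S-i (x∈p∧x≢y⇒x∈p-y (inside-circuit dependent ae≉0) e≢i))
    zero-outside : i ∉ S → a i ≈ 0#
    zero-outside i∉S with a? i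
    ... | yes ai≈0 = ai≈0
    ... | no  ai≉0 = ⊥-elim (i∉S (inside-circuit dependent ai≉0))

  support⇒circuit : ∀ {S} → Support a S → IsCircuit S
  support⇒circuit {S} supp = dependent , minimal
    where
    dependent : ¬ Independent S
    dependent independent with independent⇒avoids independent
    ... | e , ae≉0 , e∉S = ae≉0 (proj₂ (supp e) e∉S)
    minimal : ∀ e → e ∈ S → Independent (S - e)
    minimal e e∈S = independent-avoiding (proj₁ (supp e) e∈S) λ e∈S-e → x∈p-y⇒x≢y e∈S-e refl

  IsMultipleOfA : FVec (suc m) → Set L
  IsMultipleOfA X = ∃[ k ] (¬ k ≈ 0# × ∀ i → X i ∼ (k * a i))

  multipleOfA-support : ∀ {X S} → IsMultipleOfA X → Support X S → Support a S
  multipleOfA-support (k , k≉0 , X∼ka) supp i =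
    (λ i∈S ai≈0 → proj₁ (supp i) i∈S (∼-zero (X∼ka i) (trans (*-congˡ ai≈0) (zeroʳ k)))) ,
    (λ i∉S → x*y≈0⇒y≈0 k≉0 (∼-zero (∼-sym (X∼ka i)) (proj₂ (supp i) i∉S)))

  multipleOfA-unique : ∀ {X Y} → IsMultipleOfA X → IsMultipleOfA Y → ∃[ b ] (¬ b ≈ 0# × Y ≋ (λ i → b * X i))
  multipleOfA-unique (k₁ , k₁≉0 , X∼k₁a) (k₂ , k₂≉0 , Y∼k₂a) =
    b , *-nonzero k₂≉0 (⁻¹-nonzero k₁ k₁≉0) , λ i →
      ∼-trans (Y∼k₂a i) (∼-trans (∼-reflexive (rescale (a i))) (∼-*ˡ b (∼-sym (X∼k₁a i))))
    where
    b = k₂ * k₁ ⁻¹⟨ k₁≉0 ⟩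
    rescale : ∀ x → k₂ * x ≈ b * (k₁ * x)
    rescale x = trans (*-congˡ (sym (x⁻¹*[x*y]≈y k₁ k₁≉0 x))) (sym (*-assoc k₂ _ _))

  data CocircuitShape (T : Subset (suc m)) : Set ℓ where
    coloop : ∀ i → a i ≈ 0# → i ∈ T → (∀ x → x ∈ T → x ≡ i) → CocircuitShape T
    pair   : ∀ i j → i ≢ j → ¬ a i ≈ 0# → ¬ a j ≈ 0# → i ∈ T → j ∈ T →
             (∀ x → x ∈ T → x ≢ i → x ≡ j) → CocircuitShape T

  cocircuit-rest : ∀ {T e} → IsCocircuit T → e ∈ T → ∃[ f ] (¬ a f ≈ 0# × ∀ x → x ∈ T → x ≢ e → x ≡ f)
  cocircuit-rest (_ , minimal) e∈T with minimal _ e∈T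
  ... | _ , lift (f , af≉0 , refl) , avoids =
    f , af≉0 , λ x x∈T x≢e → x∉∁⁅y⁆⇒x≡y (avoids x (x∈p∧x≢y⇒x∈p-y x∈T x≢e))

  coloop-zero : ∀ {T e} → IsCocircuit T → (∀ x → x ∈ T → x ≡ e) → a e ≈ 0#
  coloop-zero {e = e} (meets , _) only-e with a? e
  ... | yes ae≈0 = ae≈0
  ... | no  ae≉0 with meets _ (basisAt ae≉0)
  ...   | x , x∈T , x∈∁e = ⊥-elim (x∈∁⁅y⁆⇒x≢y x∈∁e (only-e x x∈T))

  cocircuitShape : ∀ {T} → IsCocircuit T → CocircuitShape T
  cocircuitShape {T} cocircuit@(meets , _) with meets _ (basisAt aj₀≉0)
  ... | e , e∈T , _ with cocircuit-rest cocircuit e∈T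
  ...   | f , af≉0 , rest with f ∈? T | f ≟ e
  ...     | yes f∈T | no f≢e = pair e f (f≢e ∘ ≡.sym) ae≉0 af≉0 e∈T f∈T rest
    where
    ae≉0 : ¬ a e ≈ 0#
    ae≉0 with cocircuit-rest cocircuit f∈T
    ... | g , ag≉0 , rest′ = ≡.subst (λ x → ¬ a x ≈ 0#) (≡.sym (rest′ e e∈T (f≢e ∘ ≡.sym))) ag≉0
  ...     | yes _   | yes refl = coloop e (coloop-zero cocircuit only-e) e∈T only-e
    where
    only-e : ∀ x → x ∈ T → x ≡ e
    only-e x x∈T with x ≟ e
    ... | yes x≡e = x≡e
    ... | no  x≢e = rest x x∈T x≢e
  ...     | no f∉T  | _ = coloop e (coloop-zero cocircuit only-e) e∈T only-e
    where
    only-e : ∀ x → x ∈ T → x ≡ e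
    only-e x x∈T with x ≟ e
    ... | yes x≡e = x≡e
    ... | no  x≢e = ⊥-elim (f∉T (≡.subst (_∈ T) (rest x x∈T x≢e) x∈T))

  -- φ(aⱼ eᵢ − aᵢ eⱼ)
  pairVector : Fin (suc m) → Fin (suc m) → FVec (suc m)
  pairVector i j = updateAt (updateAt (λ _ → 0#) i (λ _ → a j)) j (λ _ → - a i)

  pairVector-i : ∀ {i j} → i ≢ j → pairVector i j i ≡ a j
  pairVector-i {i} {j} i≢j = ≡.trans (updateAt-minimal i j _ i≢j) (updateAt-updates i _)

  pairVector-j : ∀ i j → pairVector i j j ≡ - a i
  pairVector-j i j = updateAt-updates j _

  pairVector-other : ∀ {i j x} → x ≢ i → x ≢ j → pairVector i j x ≡ 0#
  pairVector-other {i} {j} {x} x≢i x≢j = ≡.trans (updateAt-minimal x j _ x≢j) (updateAt-minimal x i _ x≢i)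

  cocircuitVector : ∀ {T} → CocircuitShape T → FVec (suc m)
  cocircuitVector (coloop i _ _ _)         = unit i
  cocircuitVector (pair i j _ _ _ _ _ _)   = pairVector i j

  cocircuitVector-support : ∀ {T} (shape : CocircuitShape T) → Support (cocircuitVector shape) T
  cocircuitVector-support (coloop i _ i∈T only-i) = support-unit i∈T only-i
  cocircuitVector-support {T} (pair i j i≢j ai≉0 aj≉0 i∈T j∈T rest) x with x ≟ i | x ≟ j
  ... | yes refl | _        = (λ _ → aj≉0 ∘ trans (reflexive (≡.sym (pairVector-i i≢j)))) , λ x∉T → ⊥-elim (x∉T i∈T)
  ... | no _     | yes refl = (λ _ → -‿nonzero ai≉0 ∘ trans (reflexive (≡.sym (pairVector-j i j)))) , λ x∉T → ⊥-elim (x∉T j∈T)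
  ... | no x≢i   | no x≢j   = (λ x∈T → ⊥-elim (x≢j (rest x x∈T x≢i))) , λ _ → reflexive (pairVector-other x≢i x≢j)

  cocircuitVector-null : ∀ {T} (shape : CocircuitShape T) → Null (suc m) (λ x → a x * cocircuitVector shape x)
  cocircuitVector-null (coloop i ai≈0 _ _) = sum≈0⇒null (suc m) {λ x → a x * unit i x} (sum-zero (suc m) term≈0)
    where
    term≈0 : ∀ x → a x * unit i x ≈ 0#
    term≈0 x with x ≟ i
    ... | yes refl = trans (*-congʳ ai≈0) (zeroˡ _)
    ... | no  x≢i  = trans (*-congˡ (reflexive (unit-≢ x≢i))) (zeroʳ _)
  cocircuitVector-null (pair i j i≢j _ _ _ _ _) = sum≈0⇒null (suc m) {λ x → a x * pairVector i j x} (begin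
    sum (suc m) (λ x → a x * pairVector i j x)
      ≈⟨ sum-pair m (λ x → a x * pairVector i j x) i≢j (λ x x≢i x≢j →
           trans (*-congˡ (reflexive (pairVector-other x≢i x≢j))) (zeroʳ _)) ⟩
    a i * pairVector i j i + a j * pairVector i j j
      ≈⟨ +-cong (*-congˡ (reflexive (pairVector-i i≢j))) (*-congˡ (reflexive (pairVector-j i j))) ⟩
    a i * a j + a j * - a i
      ≈⟨ +-congˡ (trans (sym (-‿distribʳ-* (a j) (a i))) (-‿cong (*-comm (a j) (a i)))) ⟩
    a i * a j + - (a i * a j)
      ≈⟨ -‿inverseʳ _ ⟩
    0# ∎)
    where open import Relation.Binary.Reasoning.Setoid setoid

  cocircuit-proportional : ∀ {S X Y} → CocircuitShape S → Support X S → Support Y S →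
    Null (suc m) (λ i → a i * X i) → Null (suc m) (λ i → a i * Y i) → ∃[ b ] (¬ b ≈ 0# × Y ≋ (λ i → b * X i))
  cocircuit-proportional (coloop i _ i∈S only-i) suppX suppY _ _ = proportional-on-singleton suppX suppY i∈S only-i
  cocircuit-proportional {S} {X} {Y} (pair i j i≢j _ aj≉0 i∈S j∈S rest) suppX suppY nullX nullY =
    b , *-nonzero Yi≉0 (⁻¹-nonzero (X i) Xi≉0) , proportional
    where
    Xi≉0 = proj₁ (suppX i) i∈S
    Yi≉0 = proj₁ (suppY i) i∈S
    b = Y i * X i ⁻¹⟨ Xi≉0 ⟩
    Yi≈bXi : Y i ≈ b * X i
    Yi≈bXi = sym (trans (*-assoc _ _ (X i)) (trans (*-congˡ (x⁻¹*x≈1 (X i) Xi≉0)) (*-identityʳ _)))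
    outside : ∀ x → x ≢ i → x ≢ j → x ∉ S
    outside x x≢i x≢j x∈S = x≢j (rest x x∈S x≢i)
    off : ∀ {Z : FVec (suc m)} → Support Z S → ∀ x → x ≢ i → x ≢ j → Z x ≈ 0#
    off suppZ x x≢i x≢j = proj₂ (suppZ x) (outside x x≢i x≢j)
    nullbX : Null (suc m) (λ x → a x * (b * X x))
    nullbX = null-resp (suc m) (null-scale (suc m) {λ x → a x * X x} nullX b) λ x → ∼-reflexive (x∙yz≈y∙xz b (a x) (X x))
    pairOf : ∀ {Z : FVec (suc m)} → Support Z S → Null (suc m) (λ x → a x * Z x) → NullPair (a i * Z i) (a j * Z j)
    pairOf suppZ nullZ = null⇒nullPair m _ i≢j (λ x x≢i x≢j → trans (*-congˡ (off suppZ x x≢i x≢j)) (zeroʳ _)) nullZ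
    proportional : ∀ x → Y x ∼ (b * X x)
    proportional x with x ≟ i | x ≟ j
    ... | yes refl | _        = ∼-reflexive Yi≈bXi
    ... | no _     | yes refl = ∼-cancelˡ aj≉0 (nullPair-unique (pairOf suppY nullY)
                                  (pairOf (support-scale b (*-nonzero Yi≉0 (⁻¹-nonzero (X i) Xi≉0)) suppX) nullbX)
                                  (∼-reflexive (*-congˡ Yi≈bXi)))
    ... | no x≢i   | no x≢j   = ∼-reflexive (trans (off suppY x x≢i x≢j) (sym (trans (*-congˡ (off suppX x x≢i x≢j)) (zeroʳ b))))

  IsCocircuitVector : FVec (suc m) → Set L
  IsCocircuitVector Y = ∃[ T ] (Support Y T × IsCocircuit T × Null (suc m) (λ i → a i * Y i))

  dependencyFMatroid : FMatroid (suc m) m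
  dependencyFMatroid = record
    { underlying    = dependencyMatroid
    ; Circ          = IsMultipleOfA
    ; Cocirc        = IsCocircuitVector
    ; Circ-resp     = λ { (k , k≉0 , X∼ka) X≋Y → k , k≉0 , λ i → ∼-trans (∼-sym (X≋Y i)) (X∼ka i) }
    ; Cocirc-resp   = λ { (T , supp , cocircuit , null) X≋Y →
                          T , support-resp supp X≋Y , cocircuit , null-resp (suc m) null λ i → ∼-*ˡ (a i) (X≋Y i) }
    ; Circ-scale    = λ { b b≉0 (k , k≉0 , X∼ka) →
                          b * k , *-nonzero b≉0 k≉0 , λ i → ∼-trans (∼-*ˡ b (X∼ka i)) (∼-reflexive (sym (*-assoc b k (a i)))) }
    ; Cocirc-scale  = λ { {X} b b≉0 (T , supp , cocircuit , null) →
                          T , support-scale b b≉0 supp , cocircuit ,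
                          null-resp (suc m) (null-scale (suc m) {λ i → a i * X i} null b) λ i →
                            ∼-reflexive (x∙yz≈y∙xz b (a i) (X i)) }
    ; Circ-supp     = λ multiple supp → support⇒circuit (multipleOfA-support multiple supp)
    ; Cocirc-supp   = λ { (T , suppT , cocircuit , _) supp → ≡.subst IsCocircuit (support-unique suppT supp) cocircuit }
    ; Circ-exists   = λ S circuit → a , (1# , 1≉0 , λ i → ∼-reflexive (sym (*-identityˡ (a i)))) , circuit⇒support circuit
    ; Cocirc-exists = λ T cocircuit →
        let shape = cocircuitShape cocircuit
        in cocircuitVector shape , (T , cocircuitVector-support shape , cocircuit , cocircuitVector-null shape) ,
           cocircuitVector-support shape
    ; Circ-unique   = λ multipleX multipleY _ _ → multipleOfA-unique multipleX multipleY
    ; Cocirc-unique = λ { (T , suppT , cocircuit , nullX) (_ , _ , _ , nullY) suppX suppY →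
        cocircuit-proportional (cocircuitShape (≡.subst IsCocircuit (support-unique suppT suppX) cocircuit))
                               suppX suppY nullX nullY }
    ; orth          = λ { {X} {Y} (k , _ , X∼ka) (_ , _ , _ , null) → null-proportional (suc m) a Y X k null X∼ka }
    }

  rowsCovectors : ∀ {k} (B : Fin k → Fin (suc m) → Carrier) →
                  (∀ i → Null (suc m) (λ j → a j * B i j)) → RowsCovectors dependencyFMatroid B
  rowsCovectors B null i X (k , _ , X∼ka) = null-proportional (suc m) a (B i) X k (null i) X∼ka

module MatroidalRankCharacterisation {c ℓ h} (K : CommutativeRing c ℓ) (isField : IsField K)
  (H : Pred (CommutativeRing.Carrier K) h) (isH : IsUnitSubgroup K H) where
  open CommutativeRing K hiding (zero) renaming (refl to ≈-refl)
  open QuotientHyperfield K H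

  columnsIndependent⇒matroidalRank : ∀ {m n} (B : Fin m → Fin n → Carrier) →
                                     ColumnsIndependent B → MatroidalRank B n
  columnsIndependent⇒matroidalRank {n = n} B independent = (freeFMatroid , λ { _ _ (lift ()) }) , rank-bound
    where
    open FreeFMatroid K isField H isH n using (freeFMatroid)
    rank-bound : ∀ r (M : FMatroid n r) → RowsCovectors M B → n ℕ.≤ r
    rank-bound r M covectors = decidable-stable (n ℕ.≤? r) λ n≰r →
      ¬¬-circuit (ℕₚ.≰⇒> n≰r) λ (C , circuit) →
        let e , e∈C            = circuit-nonempty circuit
            X , circX , suppX = Circ-exists C circuit
        in independent (X , (e , proj₁ (suppX e) e∈C) , λ i → covectors i X circX)
      where
      open FMatroid M
      open MatroidCircuits underlying

  matroidalRank⇒columnsIndependent : ∀ {m n} (B : Fin m → Fin n → Carrier) →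
                                     MatroidalRank B n → ColumnsIndependent B
  matroidalRank⇒columnsIndependent {n = zero}  B _ (_ , (() , _) , _)
  matroidalRank⇒columnsIndependent {n = suc m} B (_ , minimal) (a , (j₀ , aj₀≉0) , null) =
    ¬¬-decidable (suc m) (λ i → a i ≈ 0#) λ a? →
      let open DependencyFMatroid K isField H isH a a? j₀ aj₀≉0
      in ℕₚ.1+n≰n (minimal m dependencyFMatroid (rowsCovectors B null))

  columnsIndependent⇔matroidalRank : ∀ {m n} (B : Fin m → Fin n → Carrier) →
                                     ColumnsIndependent B ⇔ MatroidalRank B n
  columnsIndependent⇔matroidalRank B =
    mk⇔ (columnsIndependent⇒matroidalRank B) (matroidalRank⇒columnsIndependent B)

corollary4p17 : ∀ {c ℓ h} (K : CommutativeRing c ℓ) → IsField K →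
    (H : Pred (CommutativeRing.Carrier K) h) → IsUnitSubgroup K H →
    (n : ℕ) (A : Fin n → Fin n → CommutativeRing.Carrier K) →
    let open QuotientHyperfield K H in
    (AllLiftsNonsingular A ⇔ ColumnsIndependent A)
    × (AllLiftsNonsingular A ⇔ MatroidalRank A n)
    × (AllLiftsNonsingular A ⇔ MatroidalRank (transpose A) n)
corollary4p17 K isField H isH n A =
    allLiftsNonsingular⇔columnsIndependent A
  , columnsIndependent⇔matroidalRank A ⇔-∘ allLiftsNonsingular⇔columnsIndependent A
  , columnsIndependent⇔matroidalRank (transpose A) ⇔-∘ allLiftsNonsingular⇔columnsIndependentᵀ A
  where
  open QuotientHyperfield K H using (transpose)
  open Lifts K isField H
  open MatroidalRankCharacterisation K isField H isH
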